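{- Let $\mathbb{F}$ be a field of characteristic zero. Let $P \in \mathbb{F}[x_1,\dots,x_n, y]$ and $f\in \mathbb{F}[x_1,\dots,x_n]$ be polynomials of degree $r$ and $d$ respectively, such that $P(\mathbf{x}, f(\mathbf{x})) = 0$ and $\mathcal{H}_{0}\left[\frac{\partial P}{\partial y}\left(\mathbf{x}, f(\mathbf{x}) \right)\right] = \delta \neq 0$. Let $f_0=\mathcal{H}_0[f]$ and for $j\in\{0,1,\dots,d\}$ let \[ g_j = \mathcal{H}_{\leq d}\left[ \frac{\partial^{j} P }{\partial y^j}\left(\mathbf{x}, f_0 \right)\right] - \mathcal{H}_{0}\left[ \frac{\partial^{j} P }{\partial y^j}\left(\mathbf{x}, f_0 \right)\right]. \] Then for every $i\in \{1, 2, \ldots, d\}$ there is a polynomial $A_i(z_0,\dots,z_d)$ in $d+1$ variables such that (1) $\mathcal{H}_{\leq i}\left[f\right] = \mathcal{H}_{\leq i}\left[A_i\left(g_0, g_1, \ldots, g_d\right)\right]$, and (2) $A_i$ is computable by an arithmetic circuit of size at most $10d^2i$.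
   Context: For a polynomial $R$ in variables $\mathbf{x}$, $\mathcal{H}_k[R]$ is its homogeneous component of degree $k$ and $\mathcal{H}_{\le k}[R]=\sum_{i=0}^k\mathcal{H}_i[R]$. The derivative $\frac{\partial^k P}{\partial y^k}(\mathbf{x},y)$ is the coefficient of $z^k$ in $P(\mathbf{x},y+z)$ ($z$ a new variable); $\frac{\partial P}{\partial y}(\mathbf{x},f(\mathbf{x}))$ means this derivative with $y$ replaced by $f(\mathbf{x})$. The size of an arithmetic circuit is its number of wires. -}

module Defs where

open import Level using (Level; _⊔_)
open import Algebra.Bundles using (CommutativeRing)
open import Data.Nat as ℕ using (ℕ; zero; suc; _≤_; _≟_; _≤?_)
open import Data.Fin using (Fin; zero; suc)
open import Data.Vec as Vec using (Vec; []; _∷_)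
import Data.Vec.Properties as VecP
open import Data.List as List using (List; []; _∷_; _++_; filter; concatMap; foldr; length)
open import Data.Product using (_×_; _,_; ∃; Σ-syntax)
open import Relation.Nullary using (¬_; yes; no)
open import Relation.Unary using (Pred; Decidable)
open import Relation.Binary.PropositionalEquality using (_≡_)

record Field (c ℓ : Level) : Set (Level.suc (c ⊔ ℓ)) where
  field
    commutativeRing : CommutativeRing c ℓ
  open CommutativeRing commutativeRing public
  field
    0≉1     : ¬ (0# ≈ 1#)
    inverse : ∀ x → ¬ (x ≈ 0#) → ∃ λ y → (x * y) ≈ 1#

  ⟦_⟧ℕ : ℕ → Carrier
  ⟦ zero ⟧ℕ  = 0#
  ⟦ suc n ⟧ℕ = 1# + ⟦ n ⟧ℕ

CharZero : ∀ {c ℓ} → Field c ℓ → Set ℓ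
CharZero F = ∀ n → ¬ (⟦ suc n ⟧ℕ ≈ 0#)
  where open Field F

-- Multivariate polynomials over a field, in m variables, represented
-- (sparsely) as finite lists of terms  c · x^e  (c a coefficient, e an
-- exponent vector).  Two polynomials are equal (_≋_) when all their
-- coefficients agree.

module Polynomials {c ℓ} (F : Field c ℓ) where
  open Field F using (Carrier; _≈_; _+_; _*_; -_; 0#; 1#)

  Monomial : ℕ → Set
  Monomial m = Vec ℕ m

  Poly : ℕ → Set c
  Poly m = List (Carrier × Monomial m)

  ∣_∣ : ∀ {m} → Monomial m → ℕ
  ∣ e ∣ = Vec.sum e

  coeff : ∀ {m} → Poly m → Monomial m → Carrier
  coeff [] e = 0#
  coeff ((a , e′) ∷ p) e with VecP.≡-dec _≟_ e′ e
  ... | yes _ = a + coeff p e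
  ... | no  _ = coeff p e

  infix 4 _≋_
  _≋_ : ∀ {m} → Poly m → Poly m → Set ℓ
  p ≋ q = ∀ e → coeff p e ≈ coeff q e

  HasDegree : ∀ {m} → Poly m → ℕ → Set ℓ
  HasDegree p r =
    (∀ e → r ℕ.< ∣ e ∣ → coeff p e ≈ 0#) ×
    (∃ λ e → ∣ e ∣ ≡ r × ¬ (coeff p e ≈ 0#))

  0ₚ : ∀ {m} → Poly m
  0ₚ = []

  const : ∀ {m} → Carrier → Poly m
  const a = (a , Vec.replicate _ 0) ∷ []

  1ₚ : ∀ {m} → Poly m
  1ₚ = const 1#

  var : ∀ {m} → Fin m → Poly m
  var i = (1# , Vec.updateAt (Vec.replicate _ 0) i (λ _ → 1)) ∷ []

  infixl 6 _+ₚ_ _-ₚ_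
  infixl 7 _*ₚ_

  _+ₚ_ : ∀ {m} → Poly m → Poly m → Poly m
  p +ₚ q = p ++ q

  -ₚ_ : ∀ {m} → Poly m → Poly m
  -ₚ p = List.map (λ { (a , e) → (- a , e) }) p

  _-ₚ_ : ∀ {m} → Poly m → Poly m → Poly m
  p -ₚ q = p +ₚ (-ₚ q)

  _*ₚ_ : ∀ {m} → Poly m → Poly m → Poly m
  p *ₚ q = concatMap (λ { (a , e) → List.map (λ { (b , e′) → (a * b , Vec.zipWith ℕ._+_ e e′) }) q }) p

  _^ₚ_ : ∀ {m} → Poly m → ℕ → Poly m
  p ^ₚ zero  = 1ₚ
  p ^ₚ suc k = p *ₚ (p ^ₚ k)

  sumₚ : ∀ {m} → List (Poly m) → Poly m
  sumₚ = foldr _+ₚ_ 0ₚ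

  monoEval : ∀ {k m} → Monomial k → (Fin k → Poly m) → Poly m
  monoEval [] σ = 1ₚ
  monoEval (a ∷ e) σ = (σ zero ^ₚ a) *ₚ monoEval e (λ i → σ (suc i))

  subst : ∀ {k m} → Poly k → (Fin k → Poly m) → Poly m
  subst p σ = sumₚ (List.map (λ { (a , e) → const a *ₚ monoEval e σ }) p)

  H : ∀ {m} → ℕ → Poly m → Poly m
  H k p = filter (λ t → ∣ Data.Product.proj₂ t ∣ ≟ k) p

  H≤ : ∀ {m} → ℕ → Poly m → Poly m
  H≤ k p = filter (λ t → ∣ Data.Product.proj₂ t ∣ ≤? k) p

  -- Polynomials in F[x₁,…,xₙ,y] are  Poly (suc n): variable 0 is y,
  -- variable (suc i) is x_{i+1}.

  at : ∀ {n} → Poly (suc n) → Poly n → Poly n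
  at P g = subst P λ { zero → g ; (suc i) → var i }

  -- ∂^k P / ∂y^k := coefficient of z^k in P(x, y + z).
  -- P(x, y+z) lives in Poly (suc (suc n)) with variable 0 = z,
  -- variable 1 = y, variable (2+i) = x_{i+1}.
  shiftY : ∀ {n} → Poly (suc n) → Poly (suc (suc n))
  shiftY P = subst P λ { zero → var (suc zero) +ₚ var zero ; (suc i) → var (suc (suc i)) }

  coeffZ : ∀ {n} → ℕ → Poly (suc n) → Poly n
  coeffZ k Q = List.map (λ { (a , e) → (a , Vec.tail e) })
                        (filter (λ t → Vec.head (Data.Product.proj₂ t) ≟ k) Q)

  ∂y^ : ∀ {n} → ℕ → Poly (suc n) → Poly (suc n)
  ∂y^ k P = coeffZ k (shiftY P)

  -- Arithmetic circuits over F in m input variables, as straight-line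
  -- programs (DAGs in topological order).  A gate in position k may
  -- only read gates 0 … k-1.  Leaves are variables or field constants;
  -- internal gates are + and × of arbitrary fan-in.  Size = number of
  -- wires = total fan-in.

  data Gate (m k : ℕ) : Set c where
    input : Fin m → Gate m k
    cst   : Carrier → Gate m k
    plus  : List (Fin k) → Gate m k
    times : List (Fin k) → Gate m k

  data Circuit (m : ℕ) : ℕ → Set c where
    []  : Circuit m 0
    _▷_ : ∀ {k} → Circuit m k → Gate m k → Circuit m (suc k)

  wires : ∀ {m k} → Gate m k → ℕ
  wires (input _) = 0
  wires (cst _)   = 0
  wires (plus l)  = length l
  wires (times l) = length l

  size : ∀ {m k} → Circuit m k → ℕ
  size []      = 0
  size (C ▷ g) = size C ℕ.+ wires g

  values : ∀ {m k} → Circuit m k → Fin k → Poly m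
  values (C ▷ g) zero    = gateVal g (values C)
    where
    gateVal : ∀ {m k} → Gate m k → (Fin k → Poly m) → Poly m
    gateVal (input i) v = var i
    gateVal (cst a)   v = const a
    gateVal (plus l)  v = sumₚ (List.map v l)
    gateVal (times l) v = foldr (λ j acc → v j *ₚ acc) 1ₚ l
  values (C ▷ g) (suc j) = values C j

  -- the output is the last gate
  output : ∀ {m k} → Circuit m (suc k) → Poly m
  output C = values C zero

  Computes : ∀ {m k} → Circuit m (suc k) → Poly m → Set ℓ
  Computes C p = output C ≋ p

  gPoly : ∀ {n} → Poly (suc n) → Poly n → ℕ → ℕ → Poly n
  gPoly P f d j = H≤ d (at (∂y^ j P) (H 0 f)) -ₚ H 0 (at (∂y^ j P) (H 0 f))

module Submission where

-- Write f = f₀ + u with f₀ = H₀[f] a constant and u without constant term,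
-- and put Qⱼ = ∂ʲP/∂yʲ (x, f₀).  Taylor expansion in y around f₀ turns
-- P(x, f) = 0 into  Σⱼ Qⱼ uʲ = 0.  Modulo monomials of degree > d we have
-- Qⱼ ≡ cⱼ + gⱼ with cⱼ = Qⱼ(0) ∈ 𝔽 and c₁ = δ ≠ 0.  Hence u is, modulo
-- degree > d, a fixed point of the Newton map
--     Φ(v) = v − δ⁻¹ · Σ_{j≤d} (cⱼ + gⱼ) vʲ ,
-- which is a contraction: if v ≡ w up to degree k (and both have no
-- constant term) then Φ(v) ≡ Φ(w) up to degree k+1.  So the iterates
-- U₀ = 0, U_{t+1} = Φ(U_t) satisfy U_t ≡ u up to degree t, and
-- H_{≤i}[f] = H_{≤i}[f₀ + U_i].  Each application of Φ is a Horner
-- scheme in the inputs g₀ … g_d costing 5d + 4 wires, and the constant f₀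
-- is absorbed into the last step, giving a circuit of size i(5d+4) ≤ 10d²i.

open import Defs
open import Algebra.Bundles using (CommutativeRing)
open import Data.Bool.Base using (true; false; if_then_else_)
open import Data.Empty using (⊥; ⊥-elim)
open import Data.Fin.Base using (Fin; zero; suc; toℕ)
open import Data.List.Base as List using (List; []; _∷_; _++_; concatMap; filter)
open import Data.List.Relation.Unary.All as All using (All; []; _∷_)
import Data.List.Relation.Unary.All.Properties as AllP
import Data.List.Properties as ListP
open import Data.Maybe.Base using (Maybe; just; nothing)
open import Data.Nat as ℕ using (ℕ; zero; suc; _≤_; _<_; _≟_; _≤?_; z≤n; s≤s)
import Data.Nat.Properties as ℕP
import Data.Nat.Solver
open import Data.Product using (_×_; _,_; proj₁; proj₂; ∃; ∃₂; Σ)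
open import Data.Vec.Base as Vec using ([]; _∷_)
import Data.Vec.Properties as VecP
open import Relation.Nullary using (¬_; ¬?; Dec; yes; no; does)
open import Relation.Unary using (Pred; Decidable)
open import Relation.Binary.PropositionalEquality as ≡ using (_≡_)

module FiniteSums {c ℓ} (R : CommutativeRing c ℓ) where
  open CommutativeRing R
  open import Relation.Binary.Reasoning.Setoid setoid
  open import Algebra.Properties.CommutativeSemigroup +-commutativeSemigroup using (interchange)

  ΣL : ∀ {a} {A : Set a} → List A → (A → Carrier) → Carrier
  ΣL [] f = 0#
  ΣL (x ∷ xs) f = f x + ΣL xs f

  module _ {a} {A : Set a} where
    ΣL-cong : ∀ (L : List A) {f g : A → Carrier} → (∀ x → f x ≈ g x) → ΣL L f ≈ ΣL L g
    ΣL-cong [] h = refl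
    ΣL-cong (x ∷ L) h = +-cong (h x) (ΣL-cong L h)

    ΣL-++ : ∀ (L M : List A) f → ΣL (L ++ M) f ≈ ΣL L f + ΣL M f
    ΣL-++ [] M f = sym (+-identityˡ _)
    ΣL-++ (x ∷ L) M f = trans (+-congˡ (ΣL-++ L M f)) (sym (+-assoc _ _ _))

    ΣL-+ : ∀ (L : List A) f g → ΣL L (λ x → f x + g x) ≈ ΣL L f + ΣL L g
    ΣL-+ [] f g = sym (+-identityˡ _)
    ΣL-+ (x ∷ L) f g = trans (+-congˡ (ΣL-+ L f g)) (interchange _ _ _ _)

    ΣL-*ˡ : ∀ (L : List A) k f → k * ΣL L f ≈ ΣL L (λ x → k * f x)
    ΣL-*ˡ [] k f = zeroʳ k
    ΣL-*ˡ (x ∷ L) k f = trans (distribˡ k _ _) (+-congˡ (ΣL-*ˡ L k f))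

    ΣL-*ʳ : ∀ (L : List A) k f → ΣL L f * k ≈ ΣL L (λ x → f x * k)
    ΣL-*ʳ L k f = trans (*-comm _ _) (trans (ΣL-*ˡ L k f) (ΣL-cong L (λ x → *-comm _ _)))

    ΣL-0 : ∀ (L : List A) {f} → All (λ x → f x ≈ 0#) L → ΣL L f ≈ 0#
    ΣL-0 [] [] = refl
    ΣL-0 (x ∷ L) (p ∷ ps) = trans (+-cong p (ΣL-0 L ps)) (+-identityˡ 0#)

    ΣL-0′ : ∀ (L : List A) {f} → (∀ x → f x ≈ 0#) → ΣL L f ≈ 0#
    ΣL-0′ L h = ΣL-0 L (All.universal h L)

  module _ {a b} {A : Set a} {B : Set b} where
    ΣL-map : ∀ (g : A → B) (L : List A) f → ΣL (List.map g L) f ≈ ΣL L (λ x → f (g x))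
    ΣL-map g [] f = refl
    ΣL-map g (x ∷ L) f = +-congˡ (ΣL-map g L f)

    ΣL-concatMap : ∀ (g : A → List B) (L : List A) f → ΣL (concatMap g L) f ≈ ΣL L (λ x → ΣL (g x) f)
    ΣL-concatMap g [] f = refl
    ΣL-concatMap g (x ∷ L) f = trans (ΣL-++ (g x) (concatMap g L) f) (+-congˡ (ΣL-concatMap g L f))

    ΣL-swap : ∀ (L : List A) (M : List B) (f : A → B → Carrier) →
              ΣL L (λ x → ΣL M (λ y → f x y)) ≈ ΣL M (λ y → ΣL L (λ x → f x y))
    ΣL-swap [] M f = sym (ΣL-0′ M (λ _ → refl))
    ΣL-swap (x ∷ L) M f = begin
      ΣL M (f x) + ΣL L (λ x → ΣL M (λ y → f x y)) ≈⟨ +-congˡ (ΣL-swap L M f) ⟩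
      ΣL M (f x) + ΣL M (λ y → ΣL L (λ x → f x y)) ≈⟨ sym (ΣL-+ M _ _) ⟩
      ΣL M (λ y → f x y + ΣL L (λ x → f x y)) ∎

  ΣN : ℕ → (ℕ → Carrier) → Carrier
  ΣN zero f = 0#
  ΣN (suc N) f = f 0 + ΣN N (λ j → f (suc j))

  ΣN-cong : ∀ N {f g : ℕ → Carrier} → (∀ j → f j ≈ g j) → ΣN N f ≈ ΣN N g
  ΣN-cong zero h = refl
  ΣN-cong (suc N) h = +-cong (h 0) (ΣN-cong N (λ j → h (suc j)))

  ΣN-+ : ∀ N f g → ΣN N (λ j → f j + g j) ≈ ΣN N f + ΣN N g
  ΣN-+ zero f g = sym (+-identityˡ _)
  ΣN-+ (suc N) f g = trans (+-congˡ (ΣN-+ N _ _)) (interchange _ _ _ _)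

  ΣN-0 : ∀ N {f} → (∀ j → f j ≈ 0#) → ΣN N f ≈ 0#
  ΣN-0 zero h = refl
  ΣN-0 (suc N) h = trans (+-cong (h 0) (ΣN-0 N (λ j → h (suc j)))) (+-identityˡ 0#)

  ΣN-split : ∀ a b f → ΣN (a ℕ.+ b) f ≈ ΣN a f + ΣN b (λ j → f (a ℕ.+ j))
  ΣN-split zero b f = sym (+-identityˡ _)
  ΣN-split (suc a) b f = trans (+-congˡ (ΣN-split a b (λ j → f (suc j)))) (sym (+-assoc _ _ _))

  ΣN-snoc : ∀ N f → ΣN (suc N) f ≈ ΣN N f + f N
  ΣN-snoc zero f = trans (+-identityʳ _) (sym (+-identityˡ _))
  ΣN-snoc (suc N) f = trans (+-congˡ (ΣN-snoc N (λ j → f (suc j)))) (sym (+-assoc _ _ _))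

  keep : ∀ {p} {P : Set p} → Dec P → Carrier → Carrier
  keep d a = if does d then a else 0#

  ΣN-δ : ∀ N h (g : ℕ → Carrier) → h < N → ΣN N (λ j → keep (h ≟ j) (g j)) ≈ g h
  ΣN-δ (suc N) zero g _ = trans (+-congˡ (ΣN-0 N (λ _ → refl))) (+-identityʳ _)
  ΣN-δ (suc N) (suc h) g (s≤s h<N) = trans (+-identityˡ _) (ΣN-δ N h (λ j → g (suc j)) h<N)

-- Every commutative ring R receives the canonical ring morphism ℤ → R.
-- Instantiating the standard library's ring solver with integer
-- coefficients along this morphism gives a solver for R that, unlike the
-- solver with coefficients in R itself, can see cancellations such as
-- x - x = 0.
module IntegerSolver {c ℓ} (R : CommutativeRing c ℓ) where
  open CommutativeRing R
  open import Algebra.Solver.Ring.AlmostCommutativeRing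
    using (AlmostCommutativeRing; fromCommutativeRing; _-Raw-AlmostCommutative⟶_)
  open import Data.Integer as ℤ using (ℤ; +_; -[1+_]; _⊖_; sign; ∣_∣; _◃_)
  import Data.Integer.Properties as ℤP
  import Data.Sign as Sign
  open import Algebra.Properties.Ring ring using (-1*x≈-x)
  open import Algebra.Properties.AbelianGroup +-abelianGroup using (⁻¹-involutive; ε⁻¹≈ε; ⁻¹-∙-comm)
  open import Algebra.Properties.Semiring.Mult semiring using (×-homo-+; ×1-homo-*) renaming (_×_ to _·1#-times_)
  open import Algebra.Properties.CommutativeSemigroup +-commutativeSemigroup using (interchange)
  open import Algebra.Properties.CommutativeSemigroup *-commutativeSemigroup
    using () renaming (interchange to *-interchange)
  open import Relation.Binary.Reasoning.Setoid setoid

  infix 8 _·1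
  _·1 : ℕ → Carrier
  n ·1 = n ·1#-times 1#

  ⟦_⟧ᶻ : ℤ → Carrier
  ⟦ + n ⟧ᶻ = n ·1
  ⟦ -[1+ n ] ⟧ᶻ = - (suc n ·1)

  ⟦_⟧ˢ : Sign.Sign → Carrier
  ⟦ Sign.+ ⟧ˢ = 1#
  ⟦ Sign.- ⟧ˢ = - 1#

  neg-+ : ∀ x y → - (x + y) ≈ - x + - y
  neg-+ x y = sym (⁻¹-∙-comm x y)

  ⊖-homo : ∀ m n → ⟦ m ⊖ n ⟧ᶻ ≈ m ·1 + - (n ·1)
  ⊖-homo m zero = begin
    m ·1        ≈⟨ sym (+-identityʳ _) ⟩
    m ·1 + 0#   ≈⟨ +-congˡ (sym ε⁻¹≈ε) ⟩
    m ·1 + - 0# ∎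
  ⊖-homo zero (suc n) = sym (+-identityˡ _)
  ⊖-homo (suc m) (suc n) = begin
    ⟦ suc m ⊖ suc n ⟧ᶻ                  ≡⟨ ≡.cong ⟦_⟧ᶻ (ℤP.[1+m]⊖[1+n]≡m⊖n m n) ⟩
    ⟦ m ⊖ n ⟧ᶻ                          ≈⟨ ⊖-homo m n ⟩
    m ·1 + - (n ·1)                     ≈⟨ sym (+-identityˡ _) ⟩
    0# + (m ·1 + - (n ·1))              ≈⟨ +-congʳ (sym (-‿inverseʳ 1#)) ⟩
    (1# + - 1#) + (m ·1 + - (n ·1))     ≈⟨ interchange 1# (- 1#) (m ·1) (- (n ·1)) ⟩
    (1# + m ·1) + (- 1# + - (n ·1))     ≈⟨ +-congˡ (sym (neg-+ _ _)) ⟩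
    (1# + m ·1) + - (1# + n ·1)         ∎

  ◃-homo : ∀ s n → ⟦ s ◃ n ⟧ᶻ ≈ ⟦ s ⟧ˢ * n ·1
  ◃-homo s zero = sym (zeroʳ _)
  ◃-homo Sign.+ (suc n) = sym (*-identityˡ _)
  ◃-homo Sign.- (suc n) = sym (-1*x≈-x _)

  sign-abs : ∀ i → ⟦ i ⟧ᶻ ≈ ⟦ sign i ⟧ˢ * ∣ i ∣ ·1
  sign-abs i = trans (reflexive (≡.cong ⟦_⟧ᶻ (≡.sym (ℤP.◃-inverse i)))) (◃-homo (sign i) ∣ i ∣)

  sign-homo : ∀ s t → ⟦ s Sign.* t ⟧ˢ ≈ ⟦ s ⟧ˢ * ⟦ t ⟧ˢ
  sign-homo Sign.+ t = sym (*-identityˡ _)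
  sign-homo Sign.- Sign.+ = sym (*-identityʳ _)
  sign-homo Sign.- Sign.- = begin
    1#               ≈⟨ sym (⁻¹-involutive _) ⟩
    - - 1#           ≈⟨ -‿cong (sym (-1*x≈-x 1#)) ⟩
    - (- 1# * 1#)    ≈⟨ sym (-1*x≈-x _) ⟩
    - 1# * (- 1# * 1#) ≈⟨ *-congˡ (*-identityʳ _) ⟩
    - 1# * - 1#      ∎

  *-homo : ∀ i j → ⟦ i ℤ.* j ⟧ᶻ ≈ ⟦ i ⟧ᶻ * ⟦ j ⟧ᶻ
  *-homo i j = begin
    ⟦ i ℤ.* j ⟧ᶻ                                          ≈⟨ ◃-homo (sign i Sign.* sign j) (∣ i ∣ ℕ.* ∣ j ∣) ⟩
    ⟦ sign i Sign.* sign j ⟧ˢ * (∣ i ∣ ℕ.* ∣ j ∣) ·1      ≈⟨ *-cong (sign-homo (sign i) (sign j)) (×1-homo-* ∣ i ∣ ∣ j ∣) ⟩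
    (⟦ sign i ⟧ˢ * ⟦ sign j ⟧ˢ) * (∣ i ∣ ·1 * ∣ j ∣ ·1)  ≈⟨ *-interchange _ _ _ _ ⟩
    (⟦ sign i ⟧ˢ * ∣ i ∣ ·1) * (⟦ sign j ⟧ˢ * ∣ j ∣ ·1)  ≈⟨ *-cong (sym (sign-abs i)) (sym (sign-abs j)) ⟩
    ⟦ i ⟧ᶻ * ⟦ j ⟧ᶻ                                       ∎

  +-homo : ∀ i j → ⟦ i ℤ.+ j ⟧ᶻ ≈ ⟦ i ⟧ᶻ + ⟦ j ⟧ᶻ
  +-homo (+ m) (+ n) = ×-homo-+ 1# m n
  +-homo (+ m) -[1+ n ] = ⊖-homo m (suc n)
  +-homo -[1+ m ] (+ n) = trans (⊖-homo n (suc m)) (+-comm _ _)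
  +-homo -[1+ m ] -[1+ n ] = begin
    - (suc (suc (m ℕ.+ n)) ·1)     ≡⟨ ≡.cong (λ k → - (suc k ·1)) (≡.sym (ℕP.+-suc m n)) ⟩
    - ((suc m ℕ.+ suc n) ·1)       ≈⟨ -‿cong (×-homo-+ 1# (suc m) (suc n)) ⟩
    - (suc m ·1 + suc n ·1)        ≈⟨ neg-+ _ _ ⟩
    - (suc m ·1) + - (suc n ·1)    ∎

  neg-homo : ∀ i → ⟦ ℤ.- i ⟧ᶻ ≈ - ⟦ i ⟧ᶻ
  neg-homo (+ zero) = sym ε⁻¹≈ε
  neg-homo (+ suc n) = refl
  neg-homo -[1+ n ] = sym (⁻¹-involutive _)

  ℤ⟶R : ℤ.+-*-rawRing -Raw-AlmostCommutative⟶ fromCommutativeRing R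
  ℤ⟶R = record
    { ⟦_⟧ = ⟦_⟧ᶻ ; +-homo = +-homo ; *-homo = *-homo ; -‿homo = neg-homo
    ; 0-homo = refl ; 1-homo = +-identityʳ 1# }

  ℤ-weaklyDec : ∀ i j → Maybe (⟦ i ⟧ᶻ ≈ ⟦ j ⟧ᶻ)
  ℤ-weaklyDec i j with i ℤ.≟ j
  ... | yes ≡.refl = just refl
  ... | no _ = nothing

  open import Algebra.Solver.Ring ℤ.+-*-rawRing (fromCommutativeRing R) ℤ⟶R ℤ-weaklyDec public

-- Everything is reduced to the
-- description of a coefficient as a sum over the terms of the list.
module PolynomialRing {c ℓ} (F : Field c ℓ) where
  open Polynomials F public
  open Field F hiding (commutativeRing)
  open FiniteSums (Field.commutativeRing F) public
  open import Relation.Binary.Reasoning.Setoid setoid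

  pick : ∀ {m} → Monomial m → Monomial m → Carrier → Carrier
  pick e′ e a = keep (VecP.≡-dec _≟_ e′ e) a

  coeff-Σ : ∀ {m} (p : Poly m) e → coeff p e ≈ ΣL p (λ t → pick (proj₂ t) e (proj₁ t))
  coeff-Σ [] e = refl
  coeff-Σ ((a , e′) ∷ p) e with VecP.≡-dec _≟_ e′ e
  ... | yes _ = +-congˡ (coeff-Σ p e)
  ... | no _ = trans (coeff-Σ p e) (sym (+-identityˡ _))

  keep-cong : ∀ {p} {P : Set p} (d : Dec P) {a b} → a ≈ b → keep d a ≈ keep d b
  keep-cong (yes _) h = h
  keep-cong (no _) h = refl

  keep-yes : ∀ {p} {P : Set p} (d : Dec P) {a} → P → keep d a ≈ a
  keep-yes (yes _) _ = refl
  keep-yes (no ¬p) p = ⊥-elim (¬p p)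

  keep-no : ∀ {p} {P : Set p} (d : Dec P) {a} → ¬ P → keep d a ≈ 0#
  keep-no (yes p) ¬p = ⊥-elim (¬p p)
  keep-no (no _) _ = refl

  pick-cong : ∀ {m} (e′ e : Monomial m) {a b} → a ≈ b → pick e′ e a ≈ pick e′ e b
  pick-cong e′ e = keep-cong (VecP.≡-dec _≟_ e′ e)

  pick-yes : ∀ {m} {e′ e : Monomial m} {a} → e′ ≡ e → pick e′ e a ≈ a
  pick-yes {e′ = e′} {e} = keep-yes (VecP.≡-dec _≟_ e′ e)

  pick-no : ∀ {m} {e′ e : Monomial m} {a} → ¬ e′ ≡ e → pick e′ e a ≈ 0#
  pick-no {e′ = e′} {e} = keep-no (VecP.≡-dec _≟_ e′ e)

  pick-+ : ∀ {m} (e′ e : Monomial m) a b → pick e′ e (a + b) ≈ pick e′ e a + pick e′ e b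
  pick-+ e′ e a b with VecP.≡-dec _≟_ e′ e
  ... | yes _ = refl
  ... | no _ = sym (+-identityˡ 0#)

  pick-0 : ∀ {m} (e′ e : Monomial m) → pick e′ e 0# ≈ 0#
  pick-0 e′ e with VecP.≡-dec _≟_ e′ e
  ... | yes _ = refl
  ... | no _ = refl

  pick-resp : ∀ {m} {e₁ e₂ e : Monomial m} a → e₁ ≡ e₂ → pick e₁ e a ≈ pick e₂ e a
  pick-resp a ≡.refl = refl

  infixl 6 _⊕_
  _⊕_ : ∀ {m} → Monomial m → Monomial m → Monomial m
  _⊕_ = Vec.zipWith ℕ._+_

  0s : ∀ {m} → Monomial m
  0s = Vec.replicate _ 0

  ⊕-comm : ∀ {m} (x y : Monomial m) → x ⊕ y ≡ y ⊕ x
  ⊕-comm = VecP.zipWith-comm ℕP.+-comm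

  ⊕-assoc : ∀ {m} (x y z : Monomial m) → (x ⊕ y) ⊕ z ≡ x ⊕ (y ⊕ z)
  ⊕-assoc = VecP.zipWith-assoc ℕP.+-assoc

  0s-⊕ : ∀ {m} (x : Monomial m) → 0s ⊕ x ≡ x
  0s-⊕ = VecP.zipWith-identityˡ ℕP.+-identityˡ

  ∣⊕∣ : ∀ {m} (x y : Monomial m) → ∣ x ⊕ y ∣ ≡ ∣ x ∣ ℕ.+ ∣ y ∣
  ∣⊕∣ [] [] = ≡.refl
  ∣⊕∣ (a ∷ x) (b ∷ y) = ≡.trans (≡.cong (a ℕ.+ b ℕ.+_) (∣⊕∣ x y)) (ℕ-interchange a b ∣ x ∣ ∣ y ∣)
    where open import Algebra.Properties.CommutativeSemigroup ℕP.+-commutativeSemigroup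
            using () renaming (interchange to ℕ-interchange)

  _∕_ : ∀ {m} → Monomial m → Monomial m → Maybe (Monomial m)
  [] ∕ [] = just []
  (a ∷ e) ∕ (b ∷ e₁) with b ≤? a
  ... | yes _ = Data.Maybe.Base.map ((a ℕ.∸ b) ∷_) (e ∕ e₁)
    where import Data.Maybe.Base
  ... | no _ = nothing

  ∕-sound : ∀ {m} (e e₁ : Monomial m) {d} → e ∕ e₁ ≡ just d → e₁ ⊕ d ≡ e
  ∕-sound [] [] ≡.refl = ≡.refl
  ∕-sound (a ∷ e) (b ∷ e₁) h with b ≤? a
  ∕-sound (a ∷ e) (b ∷ e₁) () | no _
  ∕-sound (a ∷ e) (b ∷ e₁) h | yes b≤a with e ∕ e₁ in eq
  ∕-sound (a ∷ e) (b ∷ e₁) ≡.refl | yes b≤a | just d′ = ≡.cong₂ _∷_ (ℕP.m+[n∸m]≡n b≤a) (∕-sound e e₁ eq)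

  ∕-complete : ∀ {m} (e₁ e₂ : Monomial m) → (e₁ ⊕ e₂) ∕ e₁ ≡ just e₂
  ∕-complete [] [] = ≡.refl
  ∕-complete (b ∷ e₁) (c ∷ e₂) with b ≤? b ℕ.+ c
  ... | yes _ rewrite ∕-complete e₁ e₂ = ≡.cong (λ k → just (k ∷ e₂)) (ℕP.m+n∸m≡n b c)
  ... | no ¬p = ⊥-elim (¬p (ℕP.m≤m+n b c))

  quotCoeff : ∀ {m} → Maybe (Monomial m) → Poly m → Carrier → Carrier
  quotCoeff nothing q a = 0#
  quotCoeff (just d) q a = a * coeff q d

  shifted-coeff : ∀ {m} (q : Poly m) (e₁ e : Monomial m) a →
                  ΣL q (λ s → pick (e₁ ⊕ proj₂ s) e (a * proj₁ s)) ≈ quotCoeff (e ∕ e₁) q a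
  shifted-coeff q e₁ e a with e ∕ e₁ in eq
  ... | nothing = ΣL-0′ q λ (b , e₂) → pick-no {e′ = e₁ ⊕ e₂} {e} λ h → nothing≢just (≡.trans (≡.sym eq) (divides h))
    where
    nothing≢just : ∀ {x : Monomial _} → nothing ≡ just x → ⊥
    nothing≢just ()
    divides : ∀ {e₂} → e₁ ⊕ e₂ ≡ e → e ∕ e₁ ≡ just e₂
    divides ≡.refl = ∕-complete e₁ _
  ... | just d = begin
      ΣL q (λ s → pick (e₁ ⊕ proj₂ s) e (a * proj₁ s)) ≈⟨ ΣL-cong q term ⟩
      ΣL q (λ s → a * pick (proj₂ s) d (proj₁ s))       ≈⟨ sym (ΣL-*ˡ q a _) ⟩
      a * ΣL q (λ s → pick (proj₂ s) d (proj₁ s))       ≈⟨ *-congˡ (sym (coeff-Σ q d)) ⟩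
      a * coeff q d                                      ∎
    where
    just-injective : ∀ {x y : Monomial _} → just x ≡ just y → x ≡ y
    just-injective ≡.refl = ≡.refl
    term : ∀ s → pick (e₁ ⊕ proj₂ s) e (a * proj₁ s) ≈ a * pick (proj₂ s) d (proj₁ s)
    term (b , e₂) with VecP.≡-dec _≟_ e₂ d
    ... | yes ≡.refl = pick-yes (∕-sound e e₁ eq)
    ... | no e₂≢d = trans (pick-no {e′ = e₁ ⊕ e₂} {e} λ h → e₂≢d (just-injective (≡.trans (≡.sym (∕-complete e₁ e₂))
                                                 (≡.trans (≡.cong (_∕ e₁) h) eq))))
                          (sym (zeroʳ a))

  coeff-* : ∀ {m} (p q : Poly m) e →
    coeff (p *ₚ q) e ≈ ΣL p (λ t → ΣL q (λ s → pick (proj₂ t ⊕ proj₂ s) e (proj₁ t * proj₁ s)))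
  coeff-* p q e = trans (coeff-Σ (p *ₚ q) e) (trans (ΣL-concatMap _ p _) (ΣL-cong p (λ t → ΣL-map _ q _)))

  coeff-*′ : ∀ {m} (p q : Poly m) e → coeff (p *ₚ q) e ≈ ΣL p (λ t → quotCoeff (e ∕ proj₂ t) q (proj₁ t))
  coeff-*′ p q e = trans (coeff-* p q e) (ΣL-cong p (λ t → shifted-coeff q (proj₂ t) e (proj₁ t)))

  coeff-++ : ∀ {m} (p q : Poly m) e → coeff (p ++ q) e ≈ coeff p e + coeff q e
  coeff-++ p q e = trans (coeff-Σ (p ++ q) e) (trans (ΣL-++ p q _) (sym (+-cong (coeff-Σ p e) (coeff-Σ q e))))

  coeff-neg : ∀ {m} (p : Poly m) e → coeff (-ₚ p) e ≈ - coeff p e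
  coeff-neg [] e = sym ε⁻¹≈ε
    where open import Algebra.Properties.Group +-group using (ε⁻¹≈ε)
  coeff-neg ((a , e′) ∷ p) e with VecP.≡-dec _≟_ e′ e
  ... | yes _ = trans (+-congˡ (coeff-neg p e)) (⁻¹-∙-comm a (coeff p e))
    where open import Algebra.Properties.AbelianGroup +-abelianGroup using (⁻¹-∙-comm)
  ... | no _ = coeff-neg p e

  ≋-reflexive : ∀ {m} {p q : Poly m} → p ≡ q → p ≋ q
  ≋-reflexive ≡.refl e = refl

  +ₚ-cong : ∀ {m} (p p′ q q′ : Poly m) → p ≋ p′ → q ≋ q′ → p +ₚ q ≋ p′ +ₚ q′
  +ₚ-cong p p′ q q′ h k e = trans (coeff-++ p q e) (trans (+-cong (h e) (k e)) (sym (coeff-++ p′ q′ e)))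

  +ₚ-comm : ∀ {m} (p q : Poly m) → p +ₚ q ≋ q +ₚ p
  +ₚ-comm p q e = trans (coeff-++ p q e) (trans (+-comm _ _) (sym (coeff-++ q p e)))

  -ₚ-cong : ∀ {m} {p q : Poly m} → p ≋ q → -ₚ p ≋ -ₚ q
  -ₚ-cong {p = p} {q} h e = trans (coeff-neg p e) (trans (-‿cong (h e)) (sym (coeff-neg q e)))

  -ₚ-inverseˡ : ∀ {m} (p : Poly m) → (-ₚ p) +ₚ p ≋ 0ₚ
  -ₚ-inverseˡ p e = trans (coeff-++ (-ₚ p) p e) (trans (+-congʳ (coeff-neg p e)) (-‿inverseˡ _))

  *ₚ-comm : ∀ {m} (p q : Poly m) → p *ₚ q ≋ q *ₚ p
  *ₚ-comm p q e = begin
    coeff (p *ₚ q) e                                                              ≈⟨ coeff-* p q e ⟩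
    ΣL p (λ t → ΣL q (λ s → pick (proj₂ t ⊕ proj₂ s) e (proj₁ t * proj₁ s)))      ≈⟨ ΣL-swap p q _ ⟩
    ΣL q (λ s → ΣL p (λ t → pick (proj₂ t ⊕ proj₂ s) e (proj₁ t * proj₁ s)))      ≈⟨ ΣL-cong q (λ s → ΣL-cong p (λ t →
       trans (pick-resp _ (⊕-comm (proj₂ t) (proj₂ s))) (pick-cong (proj₂ s ⊕ proj₂ t) e (*-comm _ _)))) ⟩
    ΣL q (λ s → ΣL p (λ t → pick (proj₂ s ⊕ proj₂ t) e (proj₁ s * proj₁ t)))      ≈⟨ sym (coeff-* q p e) ⟩
    coeff (q *ₚ p) e                                                              ∎

  *ₚ-congʳ : ∀ {m} (p : Poly m) {q q′ : Poly m} → q ≋ q′ → p *ₚ q ≋ p *ₚ q′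
  *ₚ-congʳ p {q} {q′} h e =
    trans (coeff-*′ p q e) (trans (ΣL-cong p (λ t → same (e ∕ proj₂ t) (proj₁ t))) (sym (coeff-*′ p q′ e)))
    where
    same : ∀ x a → quotCoeff x q a ≈ quotCoeff x q′ a
    same nothing a = refl
    same (just d) a = *-congˡ (h d)

  *ₚ-cong : ∀ {m} (p p′ q q′ : Poly m) → p ≋ p′ → q ≋ q′ → p *ₚ q ≋ p′ *ₚ q′
  *ₚ-cong p p′ q q′ h k e =
    trans (*ₚ-congʳ p k e) (trans (*ₚ-comm p q′ e) (trans (*ₚ-congʳ q′ h e) (*ₚ-comm q′ p′ e)))

  *ₚ-assoc : ∀ {m} (p q r : Poly m) → (p *ₚ q) *ₚ r ≋ p *ₚ (q *ₚ r)
  *ₚ-assoc p q r e = begin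
    coeff ((p *ₚ q) *ₚ r) e ≈⟨ coeff-* (p *ₚ q) r e ⟩
    ΣL (p *ₚ q) (λ u → ΣL r (λ w → pick (proj₂ u ⊕ proj₂ w) e (proj₁ u * proj₁ w))) ≈⟨ ΣL-concatMap _ p _ ⟩
    ΣL p (λ t → ΣL (List.map _ q) (λ u → ΣL r (λ w → pick (proj₂ u ⊕ proj₂ w) e (proj₁ u * proj₁ w)))) ≈⟨ ΣL-cong p (λ t → ΣL-map _ q _) ⟩
    ΣL p (λ t → ΣL q (λ s → ΣL r (λ w → pick ((proj₂ t ⊕ proj₂ s) ⊕ proj₂ w) e ((proj₁ t * proj₁ s) * proj₁ w)))) ≈⟨
       ΣL-cong p (λ t → ΣL-cong q (λ s → ΣL-cong r (λ w → trans (pick-resp _ (⊕-assoc (proj₂ t) (proj₂ s) (proj₂ w)))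
                                                               (pick-cong (proj₂ t ⊕ (proj₂ s ⊕ proj₂ w)) e (*-assoc _ _ _))))) ⟩
    ΣL p (λ t → ΣL q (λ s → ΣL r (λ w → pick (proj₂ t ⊕ (proj₂ s ⊕ proj₂ w)) e (proj₁ t * (proj₁ s * proj₁ w))))) ≈⟨
       ΣL-cong p (λ t → sym (trans (ΣL-concatMap _ q _) (ΣL-cong q (λ s → ΣL-map _ r _)))) ⟩
    ΣL p (λ t → ΣL (q *ₚ r) (λ v → pick (proj₂ t ⊕ proj₂ v) e (proj₁ t * proj₁ v))) ≈⟨ sym (coeff-* p (q *ₚ r) e) ⟩
    coeff (p *ₚ (q *ₚ r)) e ∎

  *ₚ-identityˡ : ∀ {m} (p : Poly m) → 1ₚ *ₚ p ≋ p
  *ₚ-identityˡ p e = begin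
    coeff (1ₚ *ₚ p) e                                      ≈⟨ coeff-* 1ₚ p e ⟩
    ΣL p (λ s → pick (0s ⊕ proj₂ s) e (1# * proj₁ s)) + 0# ≈⟨ +-identityʳ _ ⟩
    ΣL p (λ s → pick (0s ⊕ proj₂ s) e (1# * proj₁ s))      ≈⟨ ΣL-cong p (λ s → trans (pick-resp _ (0s-⊕ (proj₂ s)))
                                                                                      (pick-cong (proj₂ s) e (*-identityˡ _))) ⟩
    ΣL p (λ s → pick (proj₂ s) e (proj₁ s))                ≈⟨ sym (coeff-Σ p e) ⟩
    coeff p e                                              ∎

  *ₚ-distribˡ : ∀ {m} (p q r : Poly m) → p *ₚ (q +ₚ r) ≋ (p *ₚ q) +ₚ (p *ₚ r)
  *ₚ-distribˡ p q r e = begin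
    coeff (p *ₚ (q +ₚ r)) e ≈⟨ coeff-* p (q ++ r) e ⟩
    ΣL p (λ t → ΣL (q ++ r) (λ s → pick (proj₂ t ⊕ proj₂ s) e (proj₁ t * proj₁ s))) ≈⟨ ΣL-cong p (λ t → ΣL-++ q r _) ⟩
    ΣL p (λ t → ΣL q (λ s → pick (proj₂ t ⊕ proj₂ s) e (proj₁ t * proj₁ s))
              + ΣL r (λ s → pick (proj₂ t ⊕ proj₂ s) e (proj₁ t * proj₁ s))) ≈⟨ ΣL-+ p _ _ ⟩
    _ ≈⟨ sym (+-cong (coeff-* p q e) (coeff-* p r e)) ⟩
    coeff (p *ₚ q) e + coeff (p *ₚ r) e ≈⟨ sym (coeff-++ (p *ₚ q) (p *ₚ r) e) ⟩
    coeff ((p *ₚ q) +ₚ (p *ₚ r)) e ∎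

  -- _≋_ wrapped in a record, so that the polynomials it relates can be
  -- inferred (a bare function type would make them invisible to unification).
  infix 4 _≃_
  record _≃_ {m} (p q : Poly m) : Set ℓ where
    constructor ⟨_⟩
    field get : p ≋ q
  open _≃_ public

  polyRing : ℕ → CommutativeRing c ℓ
  polyRing m = record { isCommutativeRing = isCR }
    where
    open import Algebra.Structures using (IsCommutativeRing)
    isCR : IsCommutativeRing (_≃_ {m}) _+ₚ_ _*ₚ_ -ₚ_ 0ₚ 1ₚ
    isCR = record
      { isRing = record
        { +-isAbelianGroup = record
          { isGroup = record
            { isMonoid = record
              { isSemigroup = record
                { isMagma = record
                  { isEquivalence = record
                    { refl = ⟨ (λ e → refl) ⟩ ; sym = λ h → ⟨ (λ e → sym (get h e)) ⟩
                    ; trans = λ h k → ⟨ (λ e → trans (get h e) (get k e)) ⟩ }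
                  ; ∙-cong = λ {x} {y} {u} {v} h k → ⟨ +ₚ-cong x y u v (get h) (get k) ⟩ }
                ; assoc = λ p q r → ⟨ ≋-reflexive (ListP.++-assoc p q r) ⟩ }
              ; identity = (λ p → ⟨ (λ e → refl) ⟩) , (λ p → ⟨ ≋-reflexive (ListP.++-identityʳ p) ⟩) }
            ; inverse = (λ p → ⟨ -ₚ-inverseˡ p ⟩) , (λ p → ⟨ (λ e → trans (+ₚ-comm p (-ₚ p) e) (-ₚ-inverseˡ p e)) ⟩)
            ; ⁻¹-cong = λ {x} {y} h → ⟨ -ₚ-cong {p = x} {y} (get h) ⟩ }
          ; comm = λ p q → ⟨ +ₚ-comm p q ⟩ }
        ; *-cong = λ {x} {y} {u} {v} h k → ⟨ *ₚ-cong x y u v (get h) (get k) ⟩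
        ; *-assoc = λ p q r → ⟨ *ₚ-assoc p q r ⟩
        ; *-identity = (λ p → ⟨ *ₚ-identityˡ p ⟩) , (λ p → ⟨ (λ e → trans (*ₚ-comm p 1ₚ e) (*ₚ-identityˡ p e)) ⟩)
        ; distrib = (λ p q r → ⟨ *ₚ-distribˡ p q r ⟩)
                  , (λ p q r → ⟨ (λ e → trans (*ₚ-comm (q +ₚ r) p e) (trans (*ₚ-distribˡ p q r e)
                                   (+ₚ-cong (p *ₚ q) (q *ₚ p) (p *ₚ r) (r *ₚ p) (*ₚ-comm p q) (*ₚ-comm p r) e))) ⟩) }
      ; *-comm = λ p q → ⟨ *ₚ-comm p q ⟩ }

  -- congruences of _≃_ with the fixed operand explicit: it cannot be
  -- inferred, as _+ₚ_ and _*ₚ_ are not injective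
  module _ {m : ℕ} where
    private module RP = CommutativeRing (polyRing m)

    cong-*ˡ : ∀ x {y z : Poly m} → y ≃ z → x *ₚ y ≃ x *ₚ z
    cong-*ˡ x {y} {z} = RP.*-congˡ {x} {y} {z}

    cong-*ʳ : ∀ {x y : Poly m} z → x ≃ y → x *ₚ z ≃ y *ₚ z
    cong-*ʳ {x} {y} z = RP.*-congʳ {z} {x} {y}

    cong-+ˡ : ∀ x {y z : Poly m} → y ≃ z → x +ₚ y ≃ x +ₚ z
    cong-+ˡ x {y} {z} = RP.+-congˡ {x} {y} {z}

    cong-+ʳ : ∀ {x y : Poly m} z → x ≃ y → x +ₚ z ≃ y +ₚ z
    cong-+ʳ {x} {y} z = RP.+-congʳ {z} {x} {y}

module Truncation {c ℓ} (F : Field c ℓ) where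
  open PolynomialRing F
  open Field F hiding (commutativeRing)
  open import Relation.Binary.Reasoning.Setoid setoid

  coeff-filter : ∀ {m q} {Q : Pred (Monomial m) q} (Q? : Decidable Q) (p : Poly m) e →
    coeff (filter (λ t → Q? (proj₂ t)) p) e ≈ keep (Q? e) (coeff p e)
  coeff-filter Q? [] e with Q? e
  ... | yes _ = refl
  ... | no _ = refl
  coeff-filter {Q = Q} Q? ((a , e′) ∷ p) e with does (Q? e′) in Qe′
  ... | true with VecP.≡-dec _≟_ e′ e
  ...   | yes e′≡e = trans (+-congˡ (coeff-filter Q? p e)) (kept (Q? e′) (Q? e) Qe′ e′≡e)
    where
    kept : ∀ {x y} (dx : Dec (Q x)) (dy : Dec (Q y)) → does dx ≡ true → x ≡ y →
           a + keep dy (coeff p e) ≈ keep dy (a + coeff p e)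
    kept dx (yes _) _ _ = refl
    kept (yes qx) (no ¬qy) _ ≡.refl = ⊥-elim (¬qy qx)
  ...   | no _ = coeff-filter Q? p e
  coeff-filter {Q = Q} Q? ((a , e′) ∷ p) e | false with VecP.≡-dec _≟_ e′ e
  ...   | yes e′≡e = trans (coeff-filter Q? p e) (dropped (Q? e′) (Q? e) Qe′ e′≡e)
    where
    dropped : ∀ {x y} (dx : Dec (Q x)) (dy : Dec (Q y)) → does dx ≡ false → x ≡ y →
              keep dy (coeff p e) ≈ keep dy (a + coeff p e)
    dropped dx (no _) _ _ = refl
    dropped (no ¬qx) (yes qy) _ ≡.refl = ⊥-elim (¬qx qy)
  ...   | no _ = coeff-filter Q? p e

  infix 4 _≈[_]_
  record _≈[_]_ {m} (p : Poly m) (k : ℕ) (q : Poly m) : Set ℓ where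
    constructor ⟪_⟫
    field agree : ∀ e → ∣ e ∣ ≤ k → coeff p e ≈ coeff q e
  open _≈[_]_ public

  coeff-H≤ : ∀ {m} k (p : Poly m) e → coeff (H≤ k p) e ≈ keep (∣ e ∣ ≤? k) (coeff p e)
  coeff-H≤ k p e = coeff-filter (λ e → ∣ e ∣ ≤? k) p e

  coeff-H≤-low : ∀ {m} k (p : Poly m) e → ∣ e ∣ ≤ k → coeff (H≤ k p) e ≈ coeff p e
  coeff-H≤-low k p e le = trans (coeff-H≤ k p e) (keep-yes (∣ e ∣ ≤? k) le)

  H≤-≈ : ∀ {m} k {p q : Poly m} → p ≈[ k ] q → H≤ k p ≋ H≤ k q
  H≤-≈ k {p} {q} h e = trans (coeff-H≤ k p e) (trans (low (∣ e ∣ ≤? k)) (sym (coeff-H≤ k q e)))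
    where
    low : (d : Dec (∣ e ∣ ≤ k)) → keep d (coeff p e) ≈ keep d (coeff q e)
    low (yes le) = agree h e le
    low (no _) = refl

  module _ {m : ℕ} where
    ≃⇒≈ : ∀ k {p q : Poly m} → p ≃ q → p ≈[ k ] q
    ≃⇒≈ k h = ⟪ (λ e _ → get h e) ⟫

    ≈⇒≃ : ∀ {p q : Poly m} → (∀ k → p ≈[ k ] q) → p ≃ q
    ≈⇒≃ h = ⟨ (λ e → agree (h ∣ e ∣) e ℕP.≤-refl) ⟩

    ≈-refl : ∀ k {p : Poly m} → p ≈[ k ] p
    ≈-refl k = ⟪ (λ e _ → refl) ⟫

    ≈-sym : ∀ k {p q : Poly m} → p ≈[ k ] q → q ≈[ k ] p
    ≈-sym k h = ⟪ (λ e le → sym (agree h e le)) ⟫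

    ≈-trans : ∀ k {p q r : Poly m} → p ≈[ k ] q → q ≈[ k ] r → p ≈[ k ] r
    ≈-trans k h g = ⟪ (λ e le → trans (agree h e le) (agree g e le)) ⟫

    ≈-weaken : ∀ {j k} {p q : Poly m} → j ≤ k → p ≈[ k ] q → p ≈[ j ] q
    ≈-weaken j≤k h = ⟪ (λ e le → agree h e (ℕP.≤-trans le j≤k)) ⟫

    +ₚ-≈ : ∀ k {p p′ q q′ : Poly m} → p ≈[ k ] p′ → q ≈[ k ] q′ → p +ₚ q ≈[ k ] p′ +ₚ q′
    +ₚ-≈ k {p} {p′} {q} {q′} h g =
      ⟪ (λ e le → trans (coeff-++ p q e) (trans (+-cong (agree h e le) (agree g e le)) (sym (coeff-++ p′ q′ e)))) ⟫

  ∣∕∣ : ∀ {m} (e e₁ : Monomial m) {d} → e ∕ e₁ ≡ just d → ∣ d ∣ ≤ ∣ e ∣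
  ∣∕∣ e e₁ {d} h = ≡.subst (∣ d ∣ ≤_) (≡.trans (≡.sym (∣⊕∣ e₁ d)) (≡.cong ∣_∣ (∕-sound e e₁ h))) (ℕP.m≤n+m ∣ d ∣ ∣ e₁ ∣)

  *ₚ-≈ʳ : ∀ {m} k (p : Poly m) {q q′ : Poly m} → q ≈[ k ] q′ → p *ₚ q ≈[ k ] p *ₚ q′
  *ₚ-≈ʳ k p {q} {q′} h = ⟪ (λ e le →
    trans (coeff-*′ p q e) (trans (ΣL-cong p (λ t → same e le (proj₂ t) (proj₁ t))) (sym (coeff-*′ p q′ e)))) ⟫
    where
    same : ∀ e → ∣ e ∣ ≤ k → ∀ e₁ a → quotCoeff (e ∕ e₁) q a ≈ quotCoeff (e ∕ e₁) q′ a
    same e le e₁ a with e ∕ e₁ in eq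
    ... | nothing = refl
    ... | just d = *-congˡ (agree h d (ℕP.≤-trans (∣∕∣ e e₁ eq) le))

  *ₚ-≈ : ∀ {m} k {p p′ q q′ : Poly m} → p ≈[ k ] p′ → q ≈[ k ] q′ → p *ₚ q ≈[ k ] p′ *ₚ q′
  *ₚ-≈ k {p} {p′} {q} {q′} h g = ⟪ (λ e le →
    trans (agree (*ₚ-≈ʳ k p g) e le) (trans (*ₚ-comm p q′ e) (trans (agree (*ₚ-≈ʳ k q′ h) e le) (*ₚ-comm q′ p′ e)))) ⟫

  high : ∀ {m} → ℕ → Poly m → Poly m
  high a p = filter (λ t → ¬? (∣ proj₂ t ∣ ≤? a)) p

  high-≋ : ∀ {m} a (p : Poly m) → p ≈[ a ] 0ₚ → p ≋ high a p
  high-≋ a p h e = trans (split (∣ e ∣ ≤? a)) (sym (coeff-filter (λ e → ¬? (∣ e ∣ ≤? a)) p e))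
    where
    split : (d : Dec (∣ e ∣ ≤ a)) → coeff p e ≈ keep (¬? d) (coeff p e)
    split (yes le) = agree h e le
    split (no _) = refl

  -- If p vanishes up to degree a and q up to degree b, then p·q vanishes
  -- up to degree a + 1 + b: every product of surviving terms is too big.
  *-vanish : ∀ {m} a b {p q : Poly m} → p ≈[ a ] 0ₚ → q ≈[ b ] 0ₚ → p *ₚ q ≈[ a ℕ.+ suc b ] 0ₚ
  *-vanish a b {p} {q} hp hq = ⟪ vanish ⟫
    where
    too-big : ∀ {e e₁ e₂ : Monomial _} → ∣ e ∣ ≤ a ℕ.+ suc b → ¬ ∣ e₁ ∣ ≤ a → ¬ ∣ e₂ ∣ ≤ b → ¬ e₁ ⊕ e₂ ≡ e
    too-big {e₁ = e₁} {e₂} le n1 n2 ≡.refl =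
      ℕP.<⇒≱ (ℕP.+-mono-≤ (ℕP.≰⇒> n1) (ℕP.≰⇒> n2)) (≡.subst (_≤ a ℕ.+ suc b) (∣⊕∣ e₁ e₂) le)
    vanish : ∀ e → ∣ e ∣ ≤ a ℕ.+ suc b → coeff (p *ₚ q) e ≈ coeff 0ₚ e
    vanish e le = begin
      coeff (p *ₚ q) e                    ≈⟨ *ₚ-cong p (high a p) q (high b q) (high-≋ a p hp) (high-≋ b q hq) e ⟩
      coeff (high a p *ₚ high b q) e      ≈⟨ coeff-* (high a p) (high b q) e ⟩
      ΣL (high a p) (λ t → ΣL (high b q) (λ s → pick (proj₂ t ⊕ proj₂ s) e (proj₁ t * proj₁ s)))
        ≈⟨ ΣL-0 (high a p) (All.map (λ {t} nt → ΣL-0 (high b q)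
             (All.map (λ {s} ns → pick-no {e′ = proj₂ t ⊕ proj₂ s} {e} (too-big le nt ns)) (AllP.all-filter _ q)))
             (AllP.all-filter _ p)) ⟩
      0#                                  ∎

  ∣e∣≡0 : ∀ {m} (e : Monomial m) → ∣ e ∣ ≡ 0 → e ≡ 0s
  ∣e∣≡0 [] _ = ≡.refl
  ∣e∣≡0 (zero ∷ e) h = ≡.cong (0 ∷_) (∣e∣≡0 e h)

  ∣0s∣ : ∀ {m} → ∣ 0s {m} ∣ ≡ 0
  ∣0s∣ {zero} = ≡.refl
  ∣0s∣ {suc m} = ∣0s∣ {m}

  coeff-const : ∀ {m} a (e : Monomial m) → coeff (const a) e ≈ pick 0s e a
  coeff-const a e = trans (coeff-Σ (const a) e) (+-identityʳ _)

  coeff-const-0s : ∀ {m} a → coeff (const {m} a) 0s ≈ a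
  coeff-const-0s {m} a = trans (coeff-const a (0s {m})) (pick-yes {e′ = 0s {m}} {0s} ≡.refl)

  H0-const : ∀ {m} (p : Poly m) → H 0 p ≃ const (coeff p 0s)
  H0-const {m} p = ⟨ (λ e → trans (coeff-filter (λ e → ∣ e ∣ ≟ 0) p e)
                            (trans (same e (∣ e ∣ ≟ 0) (VecP.≡-dec _≟_ 0s e)) (sym (coeff-const (coeff p 0s) e)))) ⟩
    where
    same : ∀ e (d : Dec (∣ e ∣ ≡ 0)) (d′ : Dec (0s ≡ e)) → keep d (coeff p e) ≈ keep d′ (coeff p 0s)
    same e (yes h) (yes ≡.refl) = refl
    same e (yes h) (no ne) = ⊥-elim (ne (≡.sym (∣e∣≡0 e h)))
    same e (no nh) (yes ≡.refl) = ⊥-elim (nh (∣0s∣ {m}))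
    same e (no _) (no _) = refl

  ≈0⇒const : ∀ {m} {p q : Poly m} → p ≈[ 0 ] q → coeff p 0s ≈ coeff q 0s
  ≈0⇒const {m} h = agree h 0s (ℕP.≤-reflexive (∣0s∣ {m}))

  const⇒≈0 : ∀ {m} {p q : Poly m} → coeff p 0s ≈ coeff q 0s → p ≈[ 0 ] q
  const⇒≈0 {p = p} {q} h = ⟪ (λ e le → ≡.subst (λ x → coeff p x ≈ coeff q x) (≡.sym (∣e∣≡0 e (ℕP.n≤0⇒n≡0 le))) h) ⟫

  coeff-H0 : ∀ {m} (p : Poly m) → coeff (H 0 p) 0s ≈ coeff p 0s
  coeff-H0 {m} p = trans (get (H0-const p) 0s) (coeff-const-0s {m} (coeff p 0s))

  low-split : ∀ {m} d (p : Poly m) → const (coeff p 0s) +ₚ (H≤ d p -ₚ H 0 p) ≈[ d ] p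
  low-split d p = ⟪ (λ e le → begin
    coeff (const p₀ +ₚ (H≤ d p -ₚ H 0 p)) e               ≈⟨ coeff-++ (const p₀) _ e ⟩
    coeff (const p₀) e + coeff (H≤ d p -ₚ H 0 p) e       ≈⟨ +-congˡ (coeff-++ (H≤ d p) (-ₚ H 0 p) e) ⟩
    coeff (const p₀) e + (coeff (H≤ d p) e + coeff (-ₚ H 0 p) e)
      ≈⟨ +-congˡ (+-cong (coeff-H≤-low d p e le) (trans (coeff-neg (H 0 p) e) (-‿cong (get (H0-const p) e)))) ⟩
    coeff (const p₀) e + (coeff p e + - coeff (const p₀) e) ≈⟨ solve 2 (λ x y → x :+ (y :+ (:- x)) := y) refl _ _ ⟩
    coeff p e                                              ∎) ⟫
    where
    open IntegerSolver (Field.commutativeRing F) using (solve; _:+_; :-_; _:=_)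
    p₀ = coeff p 0s

  low-part-vanish : ∀ {m} d (p : Poly m) → H≤ d p -ₚ H 0 p ≈[ 0 ] 0ₚ
  low-part-vanish {m} d p = const⇒≈0 (begin
    coeff (H≤ d p -ₚ H 0 p) 0s              ≈⟨ coeff-++ (H≤ d p) (-ₚ H 0 p) 0s ⟩
    coeff (H≤ d p) 0s + coeff (-ₚ H 0 p) 0s ≈⟨ +-cong (coeff-H≤-low d p 0s (≡.subst (_≤ d) (≡.sym (∣0s∣ {m})) z≤n))
                                                        (trans (coeff-neg (H 0 p) 0s) (-‿cong (coeff-H0 p))) ⟩
    coeff p 0s + - coeff p 0s               ≈⟨ -‿inverseʳ _ ⟩
    0#                                      ∎)

module Substitution {c ℓ} (F : Field c ℓ) where
  open PolynomialRing F
  open Truncation F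
  open Field F hiding (commutativeRing; zero)

  ^ₚ-≈ : ∀ {m} k {p q : Poly m} a → p ≈[ k ] q → p ^ₚ a ≈[ k ] q ^ₚ a
  ^ₚ-≈ k zero h = ≈-refl k
  ^ₚ-≈ k {p} {q} (suc a) h = *ₚ-≈ k {p} {q} h (^ₚ-≈ k a h)

  monoEval-≈ : ∀ {j m} k (e : Monomial j) {σ τ : Fin j → Poly m} →
               (∀ i → σ i ≈[ k ] τ i) → monoEval e σ ≈[ k ] monoEval e τ
  monoEval-≈ k [] h = ≈-refl k
  monoEval-≈ k (a ∷ e) {σ} {τ} h =
    *ₚ-≈ k {σ zero ^ₚ a} {τ zero ^ₚ a} (^ₚ-≈ k a (h zero)) (monoEval-≈ k e (λ i → h (suc i)))

  monoEval-≃ : ∀ {j m} (e : Monomial j) {σ τ : Fin j → Poly m} → (∀ i → σ i ≃ τ i) → monoEval e σ ≃ monoEval e τ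
  monoEval-≃ e h = ≈⇒≃ (λ k → monoEval-≈ k e (λ i → ≃⇒≈ k (h i)))

  subst-≈ : ∀ {j m} k (p : Poly j) {σ τ : Fin j → Poly m} → (∀ i → σ i ≈[ k ] τ i) → subst p σ ≈[ k ] subst p τ
  subst-≈ k [] h = ≈-refl k
  subst-≈ k ((a , e) ∷ p) {σ} {τ} h =
    +ₚ-≈ k {const a *ₚ monoEval e σ} {const a *ₚ monoEval e τ}
      (*ₚ-≈ k {const a} {const a} (≈-refl k) (monoEval-≈ k e h)) (subst-≈ k p h)

  subst-≃ : ∀ {j m} (p : Poly j) {σ τ : Fin j → Poly m} → (∀ i → σ i ≃ τ i) → subst p σ ≃ subst p τ
  subst-≃ p h = ≈⇒≃ (λ k → subst-≈ k p (λ i → ≃⇒≈ k (h i)))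

  module _ {m : ℕ} where
    private module RP = CommutativeRing (polyRing m)
    open FiniteSums (polyRing m) using ()
      renaming (ΣL to ΣP; ΣL-cong to ΣP-cong; ΣL-*ˡ to ΣP-*ˡ; ΣL-*ʳ to ΣP-*ʳ; ΣL-map to ΣP-map; ΣL-concatMap to ΣP-concatMap)
    open import Algebra.Properties.CommutativeSemigroup RP.*-commutativeSemigroup using (interchange)
    open import Relation.Binary.Reasoning.Setoid RP.setoid

    sumₚ-map : ∀ {a} {A : Set a} (f : A → Poly m) (L : List A) → sumₚ (List.map f L) ≡ ΣP L f
    sumₚ-map f [] = ≡.refl
    sumₚ-map f (x ∷ L) = ≡.cong (f x ++_) (sumₚ-map f L)

    sumₚ-++ : ∀ (L M : List (Poly m)) → sumₚ (L ++ M) ≡ sumₚ L ++ sumₚ M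
    sumₚ-++ [] M = ≡.refl
    sumₚ-++ (x ∷ L) M = ≡.trans (≡.cong (x ++_) (sumₚ-++ L M)) (≡.sym (ListP.++-assoc x (sumₚ L) (sumₚ M)))

    ^ₚ-+ : ∀ (p : Poly m) a b → p ^ₚ (a ℕ.+ b) ≃ (p ^ₚ a) *ₚ (p ^ₚ b)
    ^ₚ-+ p zero b = RP.sym (RP.*-identityˡ (p ^ₚ b))
    ^ₚ-+ p (suc a) b = RP.trans (cong-*ˡ p (^ₚ-+ p a b)) (RP.sym (RP.*-assoc p (p ^ₚ a) (p ^ₚ b)))

    monoEval-⊕ : ∀ {j} (e₁ e₂ : Monomial j) (σ : Fin j → Poly m) → monoEval (e₁ ⊕ e₂) σ ≃ monoEval e₁ σ *ₚ monoEval e₂ σ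
    monoEval-⊕ [] [] σ = RP.sym (RP.*-identityˡ 1ₚ)
    monoEval-⊕ (a ∷ e₁) (b ∷ e₂) σ = RP.trans (RP.*-cong (^ₚ-+ (σ zero) a b) (monoEval-⊕ e₁ e₂ (λ i → σ (suc i))))
                                              (interchange (σ zero ^ₚ a) (σ zero ^ₚ b) _ _)

    monoEval-0s : ∀ {j} (σ : Fin j → Poly m) → monoEval 0s σ ≃ 1ₚ
    monoEval-0s {zero} σ = RP.refl
    monoEval-0s {suc j} σ = RP.trans (RP.*-identityˡ (monoEval 0s (λ i → σ (suc i)))) (monoEval-0s (λ i → σ (suc i)))

    monoEval-var : ∀ {j} (i : Fin j) (σ : Fin j → Poly m) →
                   monoEval (Vec.updateAt (Vec.replicate j 0) i (λ _ → 1)) σ ≃ σ i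
    monoEval-var {suc j} zero σ =
      RP.trans (cong-*ˡ (σ zero ^ₚ 1) (monoEval-0s (λ i → σ (suc i)))) (RP.trans (RP.*-identityʳ (σ zero ^ₚ 1)) (RP.*-identityʳ (σ zero)))
    monoEval-var {suc j} (suc i) σ = RP.trans (RP.*-identityˡ _) (monoEval-var i (λ i → σ (suc i)))

    const-* : ∀ a b → const {m} (a * b) ≃ const a *ₚ const b
    const-* a b = ⟨ (λ e → trans (coeff-Σ (const {m} (a * b)) e)
                           (trans (+-congʳ (pick-resp {e₁ = 0s} {0s ⊕ 0s} {e} (a * b) (≡.sym (0s-⊕ 0s))))
                                  (sym (coeff-Σ (const a *ₚ const b) e)))) ⟩

    const-+ : ∀ a b → const {m} (a + b) ≃ const a +ₚ const b
    const-+ a b = ⟨ (λ e → trans (coeff-Σ (const {m} (a + b)) e) (trans (+-identityʳ _) (trans (pick-+ 0s e a b)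
                      (sym (trans (coeff-Σ (const {m} a ++ const b) e) (+-congˡ (+-identityʳ _))))))) ⟩

    const-cong : ∀ {a b} → a ≈ b → const {m} a ≃ const b
    const-cong {a} {b} h = ⟨ (λ e → trans (coeff-Σ (const {m} a) e)
                                   (trans (+-congʳ (pick-cong 0s e h)) (sym (coeff-Σ (const {m} b) e)))) ⟩

    const-0 : const {m} 0# ≃ 0ₚ
    const-0 = ⟨ (λ e → trans (coeff-const 0# e) (pick-0 0s e)) ⟩

    termAt : ∀ {j} → (Fin j → Poly m) → Carrier × Monomial j → Poly m
    termAt σ (a , e) = const a *ₚ monoEval e σ

    subst-Σ : ∀ {j} (p : Poly j) σ → subst p σ ≡ ΣP p (termAt σ)
    subst-Σ p σ = sumₚ-map _ p

    subst-++ : ∀ {j} (p q : Poly j) (σ : Fin j → Poly m) → subst (p ++ q) σ ≃ subst p σ +ₚ subst q σ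
    subst-++ p q σ = RP.reflexive (≡.trans (≡.cong sumₚ (ListP.map-++ _ p q)) (sumₚ-++ (List.map _ p) (List.map _ q)))

    subst-* : ∀ {j} (p q : Poly j) (σ : Fin j → Poly m) → subst (p *ₚ q) σ ≃ subst p σ *ₚ subst q σ
    subst-* p q σ = begin
      subst (p *ₚ q) σ                                               ≡⟨ subst-Σ (p *ₚ q) σ ⟩
      ΣP (p *ₚ q) (termAt σ)                                         ≈⟨ ΣP-concatMap _ p (termAt σ) ⟩
      ΣP p (λ t → ΣP (List.map _ q) (termAt σ))                      ≈⟨ ΣP-cong p (λ t → ΣP-map _ q (termAt σ)) ⟩
      ΣP p (λ t → ΣP q (λ s → termAt σ (proj₁ t * proj₁ s , proj₂ t ⊕ proj₂ s))) ≈⟨ ΣP-cong p (λ t → ΣP-cong q (termAt-* t)) ⟩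
      ΣP p (λ t → ΣP q (λ s → termAt σ t *ₚ termAt σ s))              ≈⟨ ΣP-cong p (λ t → RP.sym (ΣP-*ˡ q (termAt σ t) (termAt σ))) ⟩
      ΣP p (λ t → termAt σ t *ₚ ΣP q (termAt σ))                      ≈⟨ RP.sym (ΣP-*ʳ p (ΣP q (termAt σ)) (termAt σ)) ⟩
      ΣP p (termAt σ) *ₚ ΣP q (termAt σ)                             ≡⟨ ≡.sym (≡.cong₂ _*ₚ_ (subst-Σ p σ) (subst-Σ q σ)) ⟩
      subst p σ *ₚ subst q σ                                         ∎
      where
      termAt-* : ∀ t s → termAt σ (proj₁ t * proj₁ s , proj₂ t ⊕ proj₂ s) ≃ termAt σ t *ₚ termAt σ s
      termAt-* (a , e) (b , e′) = RP.trans (RP.*-cong (const-* a b) (monoEval-⊕ e e′ σ)) (interchange (const a) (const b) (monoEval e σ) (monoEval e′ σ))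

    subst-const : ∀ {j} a (σ : Fin j → Poly m) → subst (const a) σ ≃ const a
    subst-const a σ = RP.trans (RP.+-identityʳ (const a *ₚ monoEval 0s σ)) (RP.trans (cong-*ˡ (const a) (monoEval-0s σ)) (RP.*-identityʳ (const a)))

    subst-var : ∀ {j} (i : Fin j) (σ : Fin j → Poly m) → subst (var i) σ ≃ σ i
    subst-var {j} i σ = RP.trans (RP.+-identityʳ (1ₚ *ₚ x)) (RP.trans (RP.*-identityˡ x) (monoEval-var i σ))
      where x = monoEval (Vec.updateAt (Vec.replicate j 0) i (λ _ → 1)) σ

    subst-^ : ∀ {j} (p : Poly j) a (σ : Fin j → Poly m) → subst (p ^ₚ a) σ ≃ subst p σ ^ₚ a
    subst-^ p zero σ = subst-const 1# σ
    subst-^ p (suc a) σ = RP.trans (subst-* p (p ^ₚ a) σ) (cong-*ˡ (subst p σ) (subst-^ p a σ))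

    subst-monoEval : ∀ {j k} (e : Monomial j) (σ : Fin j → Poly k) (τ : Fin k → Poly m) →
      subst (monoEval e σ) τ ≃ monoEval e (λ i → subst (σ i) τ)
    subst-monoEval [] σ τ = subst-const 1# τ
    subst-monoEval (a ∷ e) σ τ = RP.trans (subst-* (σ zero ^ₚ a) (monoEval e (λ i → σ (suc i))) τ)
      (RP.*-cong (subst-^ (σ zero) a τ) (subst-monoEval e (λ i → σ (suc i)) τ))

    subst-ΣP : ∀ {j} {A : Set c} (L : List A) (f : A → Poly j) (τ : Fin j → Poly m) →
      subst (FiniteSums.ΣL (polyRing j) L f) τ ≃ ΣP L (λ x → subst (f x) τ)
    subst-ΣP [] f τ = RP.refl
    subst-ΣP (x ∷ L) f τ = RP.trans (subst-++ (f x) _ τ) (cong-+ˡ (subst (f x) τ) (subst-ΣP L f τ))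

    subst-subst : ∀ {j k} (p : Poly j) (σ : Fin j → Poly k) (τ : Fin k → Poly m) →
      subst (subst p σ) τ ≃ subst p (λ i → subst (σ i) τ)
    subst-subst p σ τ = begin
      subst (subst p σ) τ                                      ≡⟨ ≡.cong (λ x → subst x τ) (sumₚ-as-ΣL p) ⟩
      subst (FiniteSums.ΣL (polyRing _) p σ-term) τ             ≈⟨ subst-ΣP p σ-term τ ⟩
      ΣP p (λ t → subst (σ-term t) τ)                          ≈⟨ ΣP-cong p (λ (a , e) →
         RP.trans (subst-* (const a) (monoEval e σ) τ) (RP.*-cong (subst-const a τ) (subst-monoEval e σ τ))) ⟩
      ΣP p (termAt (λ i → subst (σ i) τ))                      ≡⟨ ≡.sym (subst-Σ p _) ⟩
      subst p (λ i → subst (σ i) τ)                            ∎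
      where
      σ-term : Carrier × Monomial _ → Poly _
      σ-term (a , e) = const a *ₚ monoEval e σ
      sumₚ-as-ΣL : ∀ (L : List (Carrier × Monomial _)) → sumₚ (List.map σ-term L) ≡ FiniteSums.ΣL (polyRing _) L σ-term
      sumₚ-as-ΣL [] = ≡.refl
      sumₚ-as-ΣL (x ∷ L) = ≡.cong (σ-term x ++_) (sumₚ-as-ΣL L)

module Taylor {c ℓ} (F : Field c ℓ) where
  open PolynomialRing F
  open Truncation F
  open Substitution F
  open Field F hiding (commutativeRing; zero)

  degree₀ : ∀ {k} → Poly (suc k) → ℕ
  degree₀ [] = 0
  degree₀ ((a , e) ∷ Q) = Vec.head e ℕ.⊔ degree₀ Q

  degree₀-bound : ∀ {k} (Q : Poly (suc k)) N → degree₀ Q < N → All (λ t → Vec.head (proj₂ t) < N) Q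
  degree₀-bound [] N le = []
  degree₀-bound ((a , e) ∷ Q) N le =
    ℕP.≤-<-trans (ℕP.m≤m⊔n (Vec.head e) (degree₀ Q)) le ∷
    degree₀-bound Q N (ℕP.≤-<-trans (ℕP.m≤n⊔m (Vec.head e) (degree₀ Q)) le)

  module _ {n : ℕ} where
    private module RP = CommutativeRing (polyRing n)
    open FiniteSums (polyRing n) using () renaming (ΣN to ΣNP; ΣN-0 to ΣNP-0; ΣN-+ to ΣNP-+; ΣN-cong to ΣNP-cong; ΣN-δ to ΣNP-δ)
    open IntegerSolver (polyRing n) using (solve; _:*_; _:=_)
    open import Relation.Binary.Reasoning.Setoid RP.setoid

    y↦ : Poly n → Fin (suc n) → Poly n
    y↦ g zero = g
    y↦ g (suc i) = var i

    at-subst : ∀ (R : Poly (suc n)) g → at R g ≃ subst R (y↦ g)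
    at-subst R g = subst-≃ R (λ { zero → RP.refl ; (suc i) → RP.refl })

    at-≃ : ∀ (R : Poly (suc n)) {g h : Poly n} → g ≃ h → at R g ≃ at R h
    at-≃ R g≃h = subst-≃ R (λ { zero → g≃h ; (suc i) → RP.refl })

    at-≈ : ∀ k (R : Poly (suc n)) {g h : Poly n} → g ≈[ k ] h → at R g ≈[ k ] at R h
    at-≈ k R g≈h = subst-≈ k R (λ { zero → g≈h ; (suc i) → ≈-refl k })

    expand₀ : ∀ (Q : Poly (suc (suc n))) (τ : Fin (suc (suc n)) → Poly n) (τ′ : Fin (suc n) → Poly n) N →
      (∀ i → τ (suc i) ≃ τ′ i) → All (λ t → Vec.head (proj₂ t) < N) Q →
      subst Q τ ≃ ΣNP N (λ j → subst (coeffZ j Q) τ′ *ₚ (τ zero ^ₚ j))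
    expand₀ [] τ τ′ N h [] = RP.sym (ΣNP-0 N (λ j → RP.refl))
    expand₀ ((a , h₀ ∷ e′) ∷ Q) τ τ′ N h (h₀<N ∷ hs) = begin
      const a *ₚ monoEval (h₀ ∷ e′) τ +ₚ subst Q τ                    ≈⟨ RP.+-cong head-term (expand₀ Q τ τ′ N h hs) ⟩
      X *ₚ (z ^ₚ h₀) +ₚ ΣNP N (λ j → subst (coeffZ j Q) τ′ *ₚ (z ^ₚ j)) ≈⟨ cong-+ʳ _ (RP.sym (ΣNP-δ N h₀ (λ j → X *ₚ (z ^ₚ j)) h₀<N)) ⟩
      ΣNP N (λ j → keepₚ (h₀ ≟ j) (X *ₚ (z ^ₚ j))) +ₚ ΣNP N (λ j → subst (coeffZ j Q) τ′ *ₚ (z ^ₚ j)) ≈⟨ RP.sym (ΣNP-+ N _ _) ⟩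
      ΣNP N (λ j → keepₚ (h₀ ≟ j) (X *ₚ (z ^ₚ j)) +ₚ subst (coeffZ j Q) τ′ *ₚ (z ^ₚ j)) ≈⟨ ΣNP-cong N collect ⟩
      ΣNP N (λ j → subst (coeffZ j ((a , h₀ ∷ e′) ∷ Q)) τ′ *ₚ (z ^ₚ j)) ∎
      where
      open FiniteSums (polyRing n) using () renaming (keep to keepₚ)
      z = τ zero
      X = const a *ₚ monoEval e′ τ′
      head-term : const a *ₚ monoEval (h₀ ∷ e′) τ ≃ X *ₚ (z ^ₚ h₀)
      head-term = begin
        const a *ₚ ((z ^ₚ h₀) *ₚ monoEval e′ (λ i → τ (suc i))) ≈⟨ cong-*ˡ (const a) (cong-*ˡ (z ^ₚ h₀) (monoEval-≃ e′ h)) ⟩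
        const a *ₚ ((z ^ₚ h₀) *ₚ monoEval e′ τ′)               ≈⟨ solve 3 (λ x y w → x :* (y :* w) := (x :* w) :* y) RP.refl
                                                                         (const a) (z ^ₚ h₀) (monoEval e′ τ′) ⟩
        X *ₚ (z ^ₚ h₀)                                         ∎
      collect : ∀ j → keepₚ (h₀ ≟ j) (X *ₚ (z ^ₚ j)) +ₚ subst (coeffZ j Q) τ′ *ₚ (z ^ₚ j)
                    ≃ subst (coeffZ j ((a , h₀ ∷ e′) ∷ Q)) τ′ *ₚ (z ^ₚ j)
      collect j with h₀ ℕ.≡ᵇ j
      ... | true = RP.sym (RP.distribʳ (z ^ₚ j) X (subst (coeffZ j Q) τ′))
      ... | false = RP.refl

    subst-shiftY : ∀ (P : Poly (suc n)) (τ : Fin (suc (suc n)) → Poly n) → (∀ i → τ (suc (suc i)) ≃ var i) →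
      subst (shiftY P) τ ≃ at P (τ (suc zero) +ₚ τ zero)
    subst-shiftY P τ h = RP.trans (subst-subst P _ τ) (subst-≃ P images)
      where
      images : ∀ i → _ ≃ _
      images zero = RP.trans (subst-++ (var (suc zero)) (var zero) τ) (RP.+-cong (subst-var (suc zero) τ) (subst-var zero τ))
      images (suc i) = RP.trans (subst-var (suc (suc i)) τ) (h i)

    taylor : ∀ (P : Poly (suc n)) (f₀ u : Poly n) N → degree₀ (shiftY P) < N →
      at P (f₀ +ₚ u) ≃ ΣNP N (λ j → at (∂y^ j P) f₀ *ₚ (u ^ₚ j))
    taylor P f₀ u N bound = begin
      at P (f₀ +ₚ u)                                          ≈⟨ RP.sym (subst-shiftY P τ (λ i → RP.refl)) ⟩
      subst (shiftY P) τ                                      ≈⟨ expand₀ (shiftY P) τ (y↦ f₀) N τ-tail (degree₀-bound (shiftY P) N bound) ⟩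
      ΣNP N (λ j → subst (∂y^ j P) (y↦ f₀) *ₚ (u ^ₚ j))       ≈⟨ ΣNP-cong N (λ j → cong-*ʳ (u ^ₚ j) (RP.sym (at-subst (∂y^ j P) f₀))) ⟩
      ΣNP N (λ j → at (∂y^ j P) f₀ *ₚ (u ^ₚ j))               ∎
      where
      τ : Fin (suc (suc n)) → Poly n
      τ zero = u
      τ (suc i) = y↦ f₀ i
      τ-tail : ∀ i → τ (suc i) ≃ y↦ f₀ i
      τ-tail i = RP.refl

clamp : ∀ d → ℕ → Fin (suc d)
clamp zero _ = zero
clamp (suc d) zero = zero
clamp (suc d) (suc j) = suc (clamp d j)

toℕ-clamp : ∀ d j → j ≤ d → toℕ (clamp d j) ≡ j
toℕ-clamp zero zero _ = ≡.refl
toℕ-clamp (suc d) zero _ = ≡.refl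
toℕ-clamp (suc d) (suc j) (s≤s le) = ≡.cong suc (toℕ-clamp d j le)

module Circuits {c ℓ} (F : Field c ℓ) where
  open PolynomialRing F
  open Substitution F
  open Field F hiding (commutativeRing; zero)

  valuesAt : ∀ {m n k} → Circuit m k → (Fin m → Poly n) → Fin k → Poly n
  valuesAt (C ▷ g) σ (suc j) = valuesAt C σ j
  valuesAt (C ▷ input i) σ zero = σ i
  valuesAt (C ▷ cst a) σ zero = const a
  valuesAt (C ▷ plus l) σ zero = sumₚ (List.map (valuesAt C σ) l)
  valuesAt (C ▷ times l) σ zero = List.foldr (λ j acc → valuesAt C σ j *ₚ acc) 1ₚ l

  module _ {n : ℕ} where
    private module RP = CommutativeRing (polyRing n)

    subst-values : ∀ {m k} (C : Circuit m k) (σ : Fin m → Poly n) j → subst (values C j) σ ≃ valuesAt C σ j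
    subst-values (C ▷ g) σ (suc j) = subst-values C σ j
    subst-values (C ▷ input i) σ zero = subst-var i σ
    subst-values (C ▷ cst a) σ zero = subst-const a σ
    subst-values (C ▷ plus l) σ zero = subst-sum l
      where
      subst-sum : ∀ l → subst (sumₚ (List.map (values C) l)) σ ≃ sumₚ (List.map (valuesAt C σ) l)
      subst-sum [] = RP.refl
      subst-sum (j ∷ l) = RP.trans (subst-++ (values C j) _ σ) (RP.+-cong (subst-values C σ j) (subst-sum l))
    subst-values (C ▷ times l) σ zero = subst-prod l
      where
      subst-prod : ∀ l → subst (List.foldr (λ j acc → values C j *ₚ acc) 1ₚ l) σ
                         ≃ List.foldr (λ j acc → valuesAt C σ j *ₚ acc) 1ₚ l
      subst-prod [] = subst-const 1# σ
      subst-prod (j ∷ l) = RP.trans (subst-* (values C j) _ σ) (RP.*-cong (subst-values C σ j) (subst-prod l))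

  -- The inputs σ are the polynomials
  -- G 0, …, G d; for constants κ and e, appending `newtonStep κ C v` to a
  -- circuit whose gate v computes V yields a gate computing
  --     e · Σ_{j≤d} (κ j + G j) · Vʲ
  -- by Horner's rule, using 5d + 4 further wires.
  module NewtonCircuit {n : ℕ} (d : ℕ) (G : ℕ → Poly n) (σ : Fin (suc d) → Poly n)
                       (σ-inputs : ∀ j → j ≤ d → σ (clamp d j) ≃ G j) (e : Carrier) where
    private module RP = CommutativeRing (polyRing n)
    open FiniteSums (polyRing n) using () renaming (ΣN to ΣNP; ΣN-snoc to ΣNP-snoc)
    open IntegerSolver (polyRing n) using (solve; _:+_; _:*_; _:=_; con)
    open import Relation.Binary.Reasoning.Setoid RP.setoid
    import Data.Integer as ℤ

    coef : (ℕ → Carrier) → ℕ → Poly n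
    coef κ j = const (κ j) +ₚ G j

    series : (ℕ → Carrier) → Poly n → Poly n
    series κ v = ΣNP (suc d) (λ j → coef κ j *ₚ (v ^ₚ j))

    horner : (ℕ → Carrier) → Poly n → ℕ → Poly n → Poly n
    horner κ v zero h = h
    horner κ v (suc s) h = horner κ v s (coef κ s +ₚ v *ₚ h)

    horner-cong : ∀ κ v s {h h′} → h ≃ h′ → horner κ v s h ≃ horner κ v s h′
    horner-cong κ v zero eq = eq
    horner-cong κ v (suc s) eq = horner-cong κ v s (cong-+ˡ (coef κ s) (cong-*ˡ v eq))

    horner-sum : ∀ κ v s h → horner κ v s h ≃ ΣNP s (λ j → coef κ j *ₚ (v ^ₚ j)) +ₚ (v ^ₚ s) *ₚ h
    horner-sum κ v zero h = RP.sym (RP.trans (RP.+-identityˡ _) (RP.*-identityˡ h))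
    horner-sum κ v (suc s) h = begin
      horner κ v s (coef κ s +ₚ v *ₚ h)                    ≈⟨ horner-sum κ v s _ ⟩
      ΣNP s t +ₚ (v ^ₚ s) *ₚ (coef κ s +ₚ v *ₚ h)           ≈⟨ solve 5 (λ A B T V H → A :+ B :* (T :+ V :* H) := (A :+ T :* B) :+ (V :* B) :* H)
                                                                 RP.refl (ΣNP s t) (v ^ₚ s) (coef κ s) v h ⟩
      (ΣNP s t +ₚ t s) +ₚ (v *ₚ (v ^ₚ s)) *ₚ h              ≈⟨ cong-+ʳ _ (RP.sym (ΣNP-snoc s t)) ⟩
      ΣNP (suc s) t +ₚ (v *ₚ (v ^ₚ s)) *ₚ h                 ∎
      where t = λ j → coef κ j *ₚ (v ^ₚ j)

    -- s Horner steps as gates: the accumulator is the latest gate, v is gate `v`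
    hornerGates : ∀ {k} (κ : ℕ → Carrier) (s : ℕ) (C : Circuit (suc d) (suc k)) (v : Fin (suc k)) → Σ ℕ (λ k′ → Circuit (suc d) (suc k′))
    hornerGates κ zero C v = (_ , C)
    hornerGates κ (suc s) C v =
      hornerGates κ s ((((C ▷ times (v ∷ zero ∷ [])) ▷ input (clamp d s)) ▷ cst (κ s)) ▷ plus (zero ∷ suc zero ∷ suc (suc zero) ∷ []))
                  (suc (suc (suc (suc v))))

    newtonStep : ∀ {k} (κ : ℕ → Carrier) (C : Circuit (suc d) (suc k)) (v : Fin (suc k)) → Σ ℕ (λ k′ → Circuit (suc d) (suc k′))
    newtonStep κ C v =
      (_ , ((proj₂ (hornerGates κ d (((C ▷ input (clamp d d)) ▷ cst (κ d)) ▷ plus (zero ∷ suc zero ∷ [])) (suc (suc (suc v))))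
             ▷ cst e) ▷ times (zero ∷ suc zero ∷ [])))

    hornerGates-value : ∀ κ s {k} (C : Circuit (suc d) (suc k)) v → s ≤ d →
      valuesAt (proj₂ (hornerGates κ s C v)) σ zero ≃ horner κ (valuesAt C σ v) s (valuesAt C σ zero)
    hornerGates-value κ zero C v le = RP.refl
    hornerGates-value κ (suc s) C v le =
      RP.trans (hornerGates-value κ s _ _ (ℕP.≤-trans (ℕP.n≤1+n s) le)) (horner-cong κ V s step)
      where
      V = valuesAt C σ v
      h = valuesAt C σ zero
      step : const (κ s) +ₚ (σ (clamp d s) +ₚ ((V *ₚ (h *ₚ 1ₚ)) +ₚ 0ₚ)) ≃ coef κ s +ₚ V *ₚ h
      step = begin
        const (κ s) +ₚ (σ (clamp d s) +ₚ ((V *ₚ (h *ₚ 1ₚ)) +ₚ 0ₚ))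
          ≈⟨ cong-+ˡ (const (κ s)) (RP.+-cong (σ-inputs s (ℕP.≤-trans (ℕP.n≤1+n s) le)) (RP.+-identityʳ _)) ⟩
        const (κ s) +ₚ (G s +ₚ (V *ₚ (h *ₚ 1ₚ)))
          ≈⟨ solve 4 (λ K A V H → K :+ (A :+ V :* (H :* con (ℤ.+ 1))) := (K :+ A) :+ V :* H) RP.refl (const (κ s)) (G s) V h ⟩
        coef κ s +ₚ V *ₚ h ∎

    newtonStep-value : ∀ κ {k} (C : Circuit (suc d) (suc k)) v →
      valuesAt (proj₂ (newtonStep κ C v)) σ zero ≃ const e *ₚ series κ (valuesAt C σ v)
    newtonStep-value κ C v = begin
      const e *ₚ (valuesAt (proj₂ (hornerGates κ d C₃ (suc (suc (suc v))))) σ zero *ₚ 1ₚ) ≈⟨ cong-*ˡ (const e) (RP.*-identityʳ _) ⟩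
      const e *ₚ valuesAt (proj₂ (hornerGates κ d C₃ (suc (suc (suc v))))) σ zero        ≈⟨ cong-*ˡ (const e) (hornerGates-value κ d C₃ _ ℕP.≤-refl) ⟩
      const e *ₚ horner κ V d (valuesAt C₃ σ zero)                                      ≈⟨ cong-*ˡ (const e) (horner-cong κ V d top) ⟩
      const e *ₚ horner κ V d (coef κ d)                                                ≈⟨ cong-*ˡ (const e) (horner-sum κ V d (coef κ d)) ⟩
      const e *ₚ (ΣNP d t +ₚ (V ^ₚ d) *ₚ coef κ d)                                      ≈⟨ cong-*ˡ (const e) (RP.trans
                                                                                             (cong-+ˡ (ΣNP d t) (RP.*-comm (V ^ₚ d) (coef κ d))) (RP.sym (ΣNP-snoc d t))) ⟩
      const e *ₚ series κ V                                                             ∎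
      where
      C₃ = ((C ▷ input (clamp d d)) ▷ cst (κ d)) ▷ plus (zero ∷ suc zero ∷ [])
      V = valuesAt C σ v
      t = λ j → coef κ j *ₚ (V ^ₚ j)
      top : valuesAt C₃ σ zero ≃ coef κ d
      top = RP.trans (cong-+ˡ (const (κ d)) (RP.+-identityʳ (σ (clamp d d)))) (cong-+ˡ (const (κ d)) (σ-inputs d ℕP.≤-refl))

    hornerGates-size : ∀ κ s {k} (C : Circuit (suc d) (suc k)) v → size (proj₂ (hornerGates κ s C v)) ≡ size C ℕ.+ 5 ℕ.* s
    hornerGates-size κ zero C v = ≡.sym (ℕP.+-identityʳ (size C))
    hornerGates-size κ (suc s) C v = ≡.trans (hornerGates-size κ s _ _)
      (NS.solve 2 (λ x s → ((((x ⊕ₙ k 2) ⊕ₙ k 0) ⊕ₙ k 0) ⊕ₙ k 3) ⊕ₙ k 5 ⊗ₙ s ≐ x ⊕ₙ k 5 ⊗ₙ (k 1 ⊕ₙ s)) ≡.refl (size C) s)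
      where module NS = Data.Nat.Solver.+-*-Solver
            open NS using () renaming (_:+_ to _⊕ₙ_; _:*_ to _⊗ₙ_; _:=_ to _≐_; con to k)

    newtonStep-size : ∀ κ {k} (C : Circuit (suc d) (suc k)) v → size (proj₂ (newtonStep κ C v)) ≡ size C ℕ.+ (5 ℕ.* d ℕ.+ 4)
    newtonStep-size κ C v = ≡.trans (≡.cong (λ x → (x ℕ.+ 0) ℕ.+ 2) (hornerGates-size κ d _ _))
      (NS.solve 2 (λ x d → ((((((x ⊕ₙ k 0) ⊕ₙ k 0) ⊕ₙ k 2) ⊕ₙ k 5 ⊗ₙ d) ⊕ₙ k 0) ⊕ₙ k 2) ≐ x ⊕ₙ (k 5 ⊗ₙ d ⊕ₙ k 4)) ≡.refl (size C) d)
      where module NS = Data.Nat.Solver.+-*-Solver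
            open NS using () renaming (_:+_ to _⊕ₙ_; _:*_ to _⊗ₙ_; _:=_ to _≐_; con to k)

module Vanishing {c ℓ} (F : Field c ℓ) {n : ℕ} where
  open PolynomialRing F
  open Truncation F
  open Substitution F
  open Field F hiding (commutativeRing; zero)
  private module RP = CommutativeRing (polyRing n)
  open FiniteSums (polyRing n) using () renaming (ΣN to ΣNP; ΣN-0 to ΣNP-0; ΣN-split to ΣNP-split)
  open IntegerSolver (polyRing n) using (solve; _:+_; _:*_; _:=_; _:-_; con)
  import Data.Integer as ℤ

  ΣNP-≈ : ∀ k N {f g : ℕ → Poly n} → (∀ j → f j ≈[ k ] g j) → ΣNP N f ≈[ k ] ΣNP N g
  ΣNP-≈ k zero h = ≈-refl k
  ΣNP-≈ k (suc N) {f} {g} h = +ₚ-≈ k {f 0} {g 0} (h 0) (ΣNP-≈ k N (λ j → h (suc j)))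

  *-vanishʳ : ∀ k (q : Poly n) {p : Poly n} → p ≈[ k ] 0ₚ → q *ₚ p ≈[ k ] 0ₚ
  *-vanishʳ k q {p} h = ≈-trans k (*ₚ-≈ k {q} {q} {p} {0ₚ} (≈-refl k) h) (≃⇒≈ k (RP.zeroʳ q))

  ^-vanish : ∀ k {u : Poly n} → u ≈[ 0 ] 0ₚ → u ^ₚ suc k ≈[ k ] 0ₚ
  ^-vanish zero {u} h = ≈-trans 0 (*ₚ-≈ 0 {u} {0ₚ} {1ₚ} {1ₚ} h (≈-refl 0)) (≃⇒≈ 0 (RP.zeroˡ 1ₚ))
  ^-vanish (suc k) {u} h = *-vanish 0 k h (^-vanish k h)

  series-truncate : ∀ k N (Q : ℕ → Poly n) {u : Poly n} → u ≈[ 0 ] 0ₚ → suc k ≤ N →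
    ΣNP N (λ j → Q j *ₚ (u ^ₚ j)) ≈[ k ] ΣNP (suc k) (λ j → Q j *ₚ (u ^ₚ j))
  series-truncate k N Q {u} h le =
    ≈-trans k (≃⇒≈ k split) (≈-trans k (+ₚ-≈ k {low} {low} (≈-refl k) tail-vanishes) (≃⇒≈ k (RP.+-identityʳ low)))
    where
    t = λ j → Q j *ₚ (u ^ₚ j)
    low = ΣNP (suc k) t
    M = N ℕ.∸ suc k
    split : ΣNP N t ≃ low +ₚ ΣNP M (λ j → t (suc k ℕ.+ j))
    split = RP.trans (RP.reflexive (≡.cong (λ x → ΣNP x t) (≡.sym (ℕP.m+[n∸m]≡n le)))) (ΣNP-split (suc k) M t)
    tail-vanishes : ΣNP M (λ j → t (suc k ℕ.+ j)) ≈[ k ] 0ₚ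
    tail-vanishes = ≈-trans k (ΣNP-≈ k M (λ j → *-vanishʳ k (Q (suc k ℕ.+ j)) (≈-weaken (ℕP.m≤m+n k j) (^-vanish (k ℕ.+ j) h))))
                              (≃⇒≈ k (ΣNP-0 M (λ _ → RP.refl)))

  ≈⇒diff : ∀ k {p q : Poly n} → p ≈[ k ] q → p -ₚ q ≈[ k ] 0ₚ
  ≈⇒diff k {p} {q} h = ≈-trans k (+ₚ-≈ k {p} {q} { -ₚ q} { -ₚ q} h (≈-refl k)) (≃⇒≈ k (RP.-‿inverseʳ q))

  diff⇒≈ : ∀ k {p q : Poly n} → p -ₚ q ≈[ k ] 0ₚ → p ≈[ k ] q
  diff⇒≈ k {p} {q} h = ≈-trans k (≃⇒≈ k (solve 2 (λ p q → p := (p :- q) :+ q) RP.refl p q))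
                                 (+ₚ-≈ k {p -ₚ q} {0ₚ} {q} {q} h (≈-refl k))

  -- for a, b without constant term,  a ≈[k] b  implies  a^(j+2) ≈[k+1] b^(j+2),
  -- from  a²X − b²Y = a²(X − Y) + (a − b)(a + b)Y
  ^-contract : ∀ k j {a b : Poly n} → a ≈[ k ] b → a ≈[ 0 ] 0ₚ → b ≈[ 0 ] 0ₚ → a ^ₚ suc (suc j) ≈[ suc k ] b ^ₚ suc (suc j)
  ^-contract k j {a} {b} a≈b a0 b0 = diff⇒≈ (suc k) (≈-trans (suc k) (≃⇒≈ (suc k) expand)
    (+ₚ-≈ (suc k) {(a *ₚ a) *ₚ (X -ₚ Y)} {0ₚ} {(a -ₚ b) *ₚ ((a +ₚ b) *ₚ Y)} {0ₚ} first second))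
    where
    X = a ^ₚ j
    Y = b ^ₚ j
    expand : a ^ₚ suc (suc j) -ₚ b ^ₚ suc (suc j) ≃ (a *ₚ a) *ₚ (X -ₚ Y) +ₚ (a -ₚ b) *ₚ ((a +ₚ b) *ₚ Y)
    expand = solve 4 (λ a b X Y → a :* (a :* X) :- b :* (b :* Y) := (a :* a) :* (X :- Y) :+ (a :- b) :* ((a :+ b) :* Y)) RP.refl a b X Y
    first : (a *ₚ a) *ₚ (X -ₚ Y) ≈[ suc k ] 0ₚ
    first = ≈-weaken (ℕP.n≤1+n (suc k)) (*-vanish 1 k (*-vanish 0 0 a0 a0) (≈⇒diff k (^ₚ-≈ k j a≈b)))
    second : (a -ₚ b) *ₚ ((a +ₚ b) *ₚ Y) ≈[ suc k ] 0ₚ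
    second = ≈-weaken (ℕP.≤-reflexive (ℕP.+-comm 1 k))
               (*-vanish k 0 (≈⇒diff k a≈b)
                 (≈-trans 0 (≃⇒≈ 0 (RP.*-comm (a +ₚ b) Y)) (*-vanishʳ 0 Y (+ₚ-≈ 0 {a} {0ₚ} {b} {0ₚ} a0 b0))))

  series-contract : ∀ k N (T : ℕ → Poly n) {a b : Poly n} → T 1 ≈[ 0 ] 0ₚ →
    a ≈[ k ] b → a ≈[ 0 ] 0ₚ → b ≈[ 0 ] 0ₚ →
    ΣNP N (λ j → T j *ₚ (a ^ₚ j)) ≈[ suc k ] ΣNP N (λ j → T j *ₚ (b ^ₚ j))
  series-contract k N T {a} {b} T₁0 a≈b a0 b0 = ΣNP-≈ (suc k) N term
    where
    term : ∀ j → T j *ₚ (a ^ₚ j) ≈[ suc k ] T j *ₚ (b ^ₚ j)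
    term zero = ≈-refl (suc k)
    term (suc zero) = diff⇒≈ (suc k) (≈-trans (suc k)
      (≃⇒≈ (suc k) (solve 3 (λ T a b → T :* (a :* con (ℤ.+ 1)) :- T :* (b :* con (ℤ.+ 1)) := T :* (a :- b)) RP.refl (T 1) a b))
      (*-vanish 0 k T₁0 (≈⇒diff k a≈b)))
    term (suc (suc j)) = *ₚ-≈ (suc k) {T (suc (suc j))} {T (suc (suc j))} (≈-refl (suc k)) (^-contract k j a≈b a0 b0)

step-cost : ∀ d′ → 5 ℕ.* suc d′ ℕ.+ 4 ≤ 10 ℕ.* suc d′ ℕ.* suc d′
step-cost d′ = ℕP.≤-trans (ℕP.m≤m+n (5 ℕ.* suc d′ ℕ.+ 4) _) (ℕP.≤-reflexive (≡.sym expand))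
  where
  open Data.Nat.Solver.+-*-Solver using (solve; _:+_; _:*_; _:=_; con)
  expand : 10 ℕ.* suc d′ ℕ.* suc d′ ≡ (5 ℕ.* suc d′ ℕ.+ 4) ℕ.+ (10 ℕ.* d′ ℕ.* d′ ℕ.+ 15 ℕ.* d′ ℕ.+ 1)
  expand = solve 1 (λ x → con 10 :* (con 1 :+ x) :* (con 1 :+ x)
                       := (con 5 :* (con 1 :+ x) :+ con 4) :+ (con 10 :* x :* x :+ con 15 :* x :+ con 1)) ≡.refl d′

circuit-cost : ∀ d′ i′ → suc i′ ℕ.* (5 ℕ.* suc d′ ℕ.+ 4) ≤ 10 ℕ.* suc d′ ℕ.* suc d′ ℕ.* suc i′
circuit-cost d′ i′ = ℕP.≤-trans (ℕP.*-monoʳ-≤ (suc i′) (step-cost d′)) (ℕP.≤-reflexive (ℕP.*-comm (suc i′) _))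

module NewtonConstruction {c ℓ} (F : Field c ℓ) where
  open PolynomialRing F
  open Truncation F
  open Substitution F
  open Taylor F
  open Circuits F
  open Field F hiding (commutativeRing; zero)

  module Setting {n : ℕ} (d′ : ℕ) (P : Poly (suc n)) (f : Poly n) (P[f]≋0 : at P f ≋ 0ₚ)
                 (δ : Carrier) (∂P[f]₀≋δ : H 0 (at (∂y^ 1 P) f) ≋ const δ) (δ≉0 : ¬ (δ ≈ 0#)) where
    private module RP = CommutativeRing (polyRing n)
    open Vanishing F {n}
    open FiniteSums (polyRing n) using () renaming (ΣN to ΣNP)
    open IntegerSolver (polyRing n) using (solve; _:+_; _:*_; _:=_; _:-_; :-_; con)
    open import Relation.Binary.Reasoning.Setoid RP.setoid
    import Data.Integer as ℤ

    d : ℕ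
    d = suc d′

    f₀ᶜ : Carrier
    f₀ᶜ = coeff f 0s

    f₀ u : Poly n
    f₀ = H 0 f
    u = f -ₚ f₀

    -- Qⱼ = ∂ʲP/∂yʲ (x, f₀) = cⱼ + gⱼ up to degree d
    Q g : ℕ → Poly n
    Q j = at (∂y^ j P) f₀
    g j = gPoly P f d j

    cf : ℕ → Carrier
    cf j = coeff (Q j) 0s

    u-vanish : u ≈[ 0 ] 0ₚ
    u-vanish = ≈⇒diff 0 {f} {f₀} (const⇒≈0 {p = f} {f₀} (sym (coeff-H0 f)))

    f≃u+f₀ : f ≃ u +ₚ const f₀ᶜ
    f≃u+f₀ = RP.sym (RP.trans (cong-+ˡ u (RP.sym (H0-const f))) (solve 2 (λ f h → (f :- h) :+ h := f) RP.refl f f₀))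

    N : ℕ
    N = suc (degree₀ (shiftY P) ℕ.+ d)

    taylor-at-f : ΣNP N (λ j → Q j *ₚ (u ^ₚ j)) ≃ 0ₚ
    taylor-at-f = begin
      ΣNP N (λ j → Q j *ₚ (u ^ₚ j)) ≈⟨ RP.sym (taylor P f₀ u N (s≤s (ℕP.m≤m+n _ d))) ⟩
      at P (f₀ +ₚ u)                ≈⟨ at-≃ P (solve 2 (λ a b → a :+ (b :- a) := b) RP.refl f₀ f) ⟩
      at P f                        ≈⟨ ⟨ P[f]≋0 ⟩ ⟩
      0ₚ                            ∎

    g-vanish : ∀ j → g j ≈[ 0 ] 0ₚ
    g-vanish j = low-part-vanish d (Q j)

    -- c₁ = ∂P/∂y (0, f₀) = ∂P/∂y (0, f(0)) = δ
    c₁≈δ : cf 1 ≈ δ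
    c₁≈δ = trans (≈0⇒const (at-≈ 0 (∂y^ 1 P) f₀≈f))
             (trans (sym (coeff-H0 (at (∂y^ 1 P) f))) (trans (∂P[f]₀≋δ 0s) (coeff-const-0s {n} δ)))
      where
      f₀≈f : f₀ ≈[ 0 ] f
      f₀≈f = const⇒≈0 {p = f₀} {f} (coeff-H0 f)

    full-series : Poly n → Poly n
    full-series v = ΣNP (suc d) (λ j → (const (cf j) +ₚ g j) *ₚ (v ^ₚ j))

    residual : full-series u ≈[ d ] 0ₚ
    residual = ≈-trans d (ΣNP-≈ d (suc d) (λ j → *ₚ-≈ d {const (cf j) +ₚ g j} {Q j} {u ^ₚ j} {u ^ₚ j} (low-split d (Q j)) (≈-refl d)))
                (≈-trans d (≈-sym d (series-truncate d N Q u-vanish (s≤s (ℕP.m≤n+m d _)))) (≃⇒≈ d taylor-at-f))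

    -- The inputs of the circuits are the gⱼ; the Horner
    -- coefficients κ a correct c₁ by −δ (Newton's correction) and c₀ by
    -- −a (a = 0 except in the last step, which adds the constant f₀).
    δ⁻¹ e : Carrier
    δ⁻¹ = proj₁ (inverse δ δ≉0)
    e = - δ⁻¹

    κ : Carrier → ℕ → Carrier
    κ a zero = cf 0 + - a
    κ a (suc zero) = cf 1 + - δ
    κ a (suc (suc j)) = cf (suc (suc j))

    σ : Fin (suc d) → Poly n
    σ j = gPoly P f d (toℕ j)

    σ-inputs : ∀ j → j ≤ d → σ (clamp d j) ≃ g j
    σ-inputs j le = RP.reflexive (≡.cong (gPoly P f d) (toℕ-clamp d j le))

    open NewtonCircuit d g σ σ-inputs e

    Φ : Carrier → Poly n → Poly n
    Φ a v = const e *ₚ series (κ a) v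

    series-κ : ∀ a v → series (κ a) v ≃ (full-series v -ₚ const δ *ₚ v) -ₚ const a
    series-κ a v = begin
      (coef (κ a) 0 *ₚ 1ₚ) +ₚ ((coef (κ a) 1 *ₚ (v *ₚ 1ₚ)) +ₚ R)
        ≈⟨ RP.+-cong (cong-*ʳ 1ₚ (cong-+ʳ (g 0) (const-+ (cf 0) (- a))))
                     (cong-+ʳ R (cong-*ʳ (v *ₚ 1ₚ) (cong-+ʳ (g 1) (const-+ (cf 1) (- δ))))) ⟩
      (((C₀ -ₚ A) +ₚ g 0) *ₚ 1ₚ) +ₚ ((((C₁ -ₚ D) +ₚ g 1) *ₚ (v *ₚ 1ₚ)) +ₚ R)
        ≈⟨ solve 8 (λ C₀ A G₀ C₁ D G₁ V R →
                      (((C₀ :- A) :+ G₀) :* con (ℤ.+ 1)) :+ ((((C₁ :- D) :+ G₁) :* (V :* con (ℤ.+ 1))) :+ R)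
                   := (((C₀ :+ G₀) :* con (ℤ.+ 1) :+ ((C₁ :+ G₁) :* (V :* con (ℤ.+ 1)) :+ R)) :- D :* V) :- A)
                   RP.refl C₀ A (g 0) C₁ D (g 1) v R ⟩
      (full-series v -ₚ const δ *ₚ v) -ₚ const a ∎
      where
      C₀ = const (cf 0)
      C₁ = const (cf 1)
      A = const a
      D = const δ
      R = ΣNP d′ (λ j → coef (κ a) (suc (suc j)) *ₚ (v *ₚ (v *ₚ (v ^ₚ j))))

    newton-core : Poly n → Poly n
    newton-core v = v +ₚ const e *ₚ full-series v

    e·δ : const e *ₚ const δ ≃ -ₚ 1ₚ
    e·δ = RP.trans (RP.sym (const-* e δ)) (const-cong (trans (sym (-‿distribˡ-* δ⁻¹ δ)) (-‿cong (trans (*-comm δ⁻¹ δ) (proj₂ (inverse δ δ≉0))))))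
      where open import Algebra.Properties.Ring (Field.ring F) using (-‿distribˡ-*)

    -e·a : ∀ a → -ₚ (const e *ₚ const a) ≃ const (δ⁻¹ * a)
    -e·a a = RP.trans (RP.-‿cong (RP.sym (const-* e a))) (const-cong (trans (-‿cong (sym (-‿distribˡ-* δ⁻¹ a))) (⁻¹-involutive _)))
      where open import Algebra.Properties.Ring (Field.ring F) using (-‿distribˡ-*)
            open import Algebra.Properties.AbelianGroup (Field.+-abelianGroup F) using (⁻¹-involutive)

    Φ-core : ∀ a v → Φ a v ≃ newton-core v +ₚ const (δ⁻¹ * a)
    Φ-core a v = begin
      const e *ₚ series (κ a) v                                    ≈⟨ cong-*ˡ (const e) (series-κ a v) ⟩
      const e *ₚ ((full-series v -ₚ const δ *ₚ v) -ₚ const a)     ≈⟨ solve 5 (λ E S D V A →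
          E :* ((S :- D :* V) :- A) := ((:- (E :* D)) :* V :+ E :* S) :+ (:- (E :* A))) RP.refl (const e) (full-series v) (const δ) v (const a) ⟩
      ((-ₚ (const e *ₚ const δ)) *ₚ v +ₚ const e *ₚ full-series v) +ₚ -ₚ (const e *ₚ const a)
        ≈⟨ RP.+-cong (cong-+ʳ (const e *ₚ full-series v) (cong-*ʳ v (RP.-‿cong e·δ))) (-e·a a) ⟩
      ((-ₚ (-ₚ 1ₚ)) *ₚ v +ₚ const e *ₚ full-series v) +ₚ const (δ⁻¹ * a)
        ≈⟨ cong-+ʳ (const (δ⁻¹ * a)) (cong-+ʳ (const e *ₚ full-series v) (solve 1 (λ V → (:- (:- con (ℤ.+ 1))) :* V := V) RP.refl v)) ⟩
      newton-core v +ₚ const (δ⁻¹ * a)                             ∎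

    Φ₀-core : ∀ v → Φ 0# v ≃ newton-core v
    Φ₀-core v = RP.trans (Φ-core 0# v) (RP.trans (cong-+ˡ (newton-core v) (RP.trans (const-cong (zeroʳ δ⁻¹)) const-0))
                                                (RP.+-identityʳ (newton-core v)))

    fixed-point : u ≈[ d ] Φ 0# u
    fixed-point = ≈-sym d (≈-trans d (≃⇒≈ d (Φ₀-core u))
      (≈-trans d (+ₚ-≈ d {u} {u} {const e *ₚ full-series u} {0ₚ} (≈-refl d) (*-vanishʳ d (const e) residual))
                 (≃⇒≈ d (RP.+-identityʳ u))))

    coef₁-vanish : coef (κ 0#) 1 ≈[ 0 ] 0ₚ
    coef₁-vanish = const⇒≈0 {p = coef (κ 0#) 1} {0ₚ}   -- (c₁ − δ) + g₁(0) = (δ − δ) + 0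
      (trans (coeff-++ (const (cf 1 + - δ)) (g 1) 0s)
      (trans (+-cong (coeff-const-0s {n} _) (≈0⇒const (g-vanish 1)))
      (trans (+-identityʳ _) (trans (+-congʳ c₁≈δ) (-‿inverseʳ δ)))))

    contraction : ∀ k {a b : Poly n} → a ≈[ k ] b → a ≈[ 0 ] 0ₚ → b ≈[ 0 ] 0ₚ → Φ 0# a ≈[ suc k ] Φ 0# b
    contraction k {a} {b} a≈b a0 b0 = *ₚ-≈ (suc k) {const e} {const e} {series (κ 0#) a} {series (κ 0#) b}
      (≈-refl (suc k)) (series-contract k (suc d) (coef (κ 0#)) coef₁-vanish a≈b a0 b0)

    iterate : ℕ → Σ ℕ (λ k → Circuit (suc d) (suc k))
    iterate zero = (0 , ([] ▷ cst 0#))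
    iterate (suc t) = newtonStep (κ 0#) (proj₂ (iterate t)) zero

    U : ℕ → Poly n
    U t = valuesAt (proj₂ (iterate t)) σ zero

    iterate-approx : ∀ t → t ≤ d → u ≈[ t ] U t
    iterate-approx zero _ = ≈-trans 0 u-vanish (≃⇒≈ 0 (RP.sym const-0))
    iterate-approx (suc t) le =
      ≈-trans (suc t) (≈-weaken le fixed-point)
        (≈-trans (suc t) (contraction t u≈U u-vanish Uₜ-vanish)
                         (≃⇒≈ (suc t) (RP.sym (newtonStep-value (κ 0#) (proj₂ (iterate t)) zero))))
      where
      u≈U = iterate-approx t (ℕP.≤-trans (ℕP.n≤1+n t) le)
      Uₜ-vanish : U t ≈[ 0 ] 0ₚ
      Uₜ-vanish = ≈-trans 0 (≈-sym 0 (≈-weaken z≤n u≈U)) u-vanish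

    -- The circuit of the lemma: i′ Newton steps, then a last one which
    -- also adds the constant f₀ (through a = δ·f₀ᶜ).
    circuit : ℕ → Σ ℕ (λ k → Circuit (suc d) (suc k))
    circuit i′ = newtonStep (κ (δ * f₀ᶜ)) (proj₂ (iterate i′)) zero

    A : ℕ → Poly (suc d)
    A i′ = output (proj₂ (circuit i′))

    circuit-value : ∀ i′ → subst (A i′) σ ≃ U (suc i′) +ₚ const f₀ᶜ
    circuit-value i′ = begin
      subst (A i′) σ                                   ≈⟨ subst-values (proj₂ (circuit i′)) σ zero ⟩
      valuesAt (proj₂ (circuit i′)) σ zero             ≈⟨ newtonStep-value (κ (δ * f₀ᶜ)) (proj₂ (iterate i′)) zero ⟩
      Φ (δ * f₀ᶜ) (U i′)                               ≈⟨ Φ-core (δ * f₀ᶜ) (U i′) ⟩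
      newton-core (U i′) +ₚ const (δ⁻¹ * (δ * f₀ᶜ))    ≈⟨ RP.+-cong (RP.sym (Φ₀-core (U i′))) (const-cong δ⁻¹δf≈f) ⟩
      Φ 0# (U i′) +ₚ const f₀ᶜ                         ≈⟨ cong-+ʳ (const f₀ᶜ) (RP.sym (newtonStep-value (κ 0#) (proj₂ (iterate i′)) zero)) ⟩
      U (suc i′) +ₚ const f₀ᶜ                          ∎
      where
      δ⁻¹δf≈f : δ⁻¹ * (δ * f₀ᶜ) ≈ f₀ᶜ
      δ⁻¹δf≈f = trans (sym (*-assoc δ⁻¹ δ f₀ᶜ)) (trans (*-congʳ (trans (*-comm δ⁻¹ δ) (proj₂ (inverse δ δ≉0)))) (*-identityˡ f₀ᶜ))

    approximation : ∀ i′ → i′ ≤ d′ → f ≈[ suc i′ ] subst (A i′) σ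
    approximation i′ i′≤d′ =
      ≈-trans (suc i′) (≃⇒≈ (suc i′) f≃u+f₀)
        (≈-trans (suc i′) (+ₚ-≈ (suc i′) {u} {U (suc i′)} {const f₀ᶜ} {const f₀ᶜ} (iterate-approx (suc i′) (s≤s i′≤d′)) (≈-refl (suc i′)))
                          (≃⇒≈ (suc i′) (RP.sym (circuit-value i′))))

    iterate-size : ∀ t → size (proj₂ (iterate t)) ≡ t ℕ.* (5 ℕ.* d ℕ.+ 4)
    iterate-size zero = ≡.refl
    iterate-size (suc t) = ≡.trans (newtonStep-size (κ 0#) (proj₂ (iterate t)) zero)
      (≡.trans (≡.cong (ℕ._+ (5 ℕ.* d ℕ.+ 4)) (iterate-size t)) (ℕP.+-comm (t ℕ.* (5 ℕ.* d ℕ.+ 4)) (5 ℕ.* d ℕ.+ 4)))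

    circuit-size : ∀ i′ → size (proj₂ (circuit i′)) ≤ 10 ℕ.* d ℕ.* d ℕ.* suc i′
    circuit-size i′ = ℕP.≤-trans (ℕP.≤-reflexive (≡.trans (newtonStep-size (κ (δ * f₀ᶜ)) (proj₂ (iterate i′)) zero)
                                    (≡.trans (≡.cong (ℕ._+ w) (iterate-size i′)) (ℕP.+-comm (i′ ℕ.* w) w))))
                                  (circuit-cost d′ i′)
      where w = 5 ℕ.* d ℕ.+ 4

open import Data.Nat.Base using (_*_)

lemma5p3 : ∀ {c ℓ} (F : Field c ℓ) → CharZero F →
    let open Polynomials F
    in ∀ (n r d : ℕ) (P : Poly (suc n)) (f : Poly n) →
    HasDegree P r → HasDegree f d →
    at P f ≋ 0ₚ →
    (∃ λ (δ : Field.Carrier F) →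
    H 0 (at (∂y^ 1 P) f) ≋ const δ × ¬ (Field._≈_ F δ (Field.0# F))) →
    ∀ (i : ℕ) → 1 ≤ i → i ≤ d →
    ∃ λ (A : Poly (suc d)) →
    (H≤ i f ≋ H≤ i (subst A (λ j → gPoly P f d (toℕ j)))) ×
    ∃₂ λ (k : ℕ) (C : Circuit (suc d) (suc k)) →
    Computes C A × size C ≤ 10 * d * d * i
lemma5p3 F _ n r zero P f _ _ _ _ (suc i′) (s≤s z≤n) ()
lemma5p3 F _ n r (suc d′) P f _ _ P[f]≋0 (δ , ∂P[f]₀≋δ , δ≉0) (suc i′) (s≤s z≤n) (s≤s i′≤d′) =
  A i′ , Truncation.H≤-≈ F (suc i′) (approximation i′ i′≤d′) ,
  proj₁ (circuit i′) , proj₂ (circuit i′) , (λ _ → Field.refl F) , circuit-size i′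
  where open NewtonConstruction.Setting F d′ P f P[f]≋0 δ ∂P[f]₀≋δ δ≉0
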